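{- For a position $P$ (a finite multiset of terms $q_i$) of the Fibonacci Quilt Game, let $\Phi(P)=\sum_{q_i\in P}\sqrt{i}$, the sum taken over the elements of $P$ counted with multiplicity. Then every move of the game other than Rule (2a), $q_1,q_5\to q_2,q_4$, strictly decreases $\Phi$; moreover, in any play of the game Rule (2a) is used at most once.
   Context: Let $(q_i)_{i\ge1}$ be the Fibonacci Quilt sequence: $q_1=1,q_2=2,q_3=3,q_4=4$ and $q_i=q_{i-3}+q_{i-2}$ for $i\ge5$. The Fibonacci Quilt Game on $n$: a position is a finite multiset of terms $q_i$ (recorded by their indices); the initial position is $n$ copies of $q_1$. A move replaces two elements of the current multiset (with multiplicity) by one or two elements according to one of the following rules: (1a) $q_1,q_2\to q_3$; (1b) for $i\ge2$, $q_i,q_{i+1}\to q_{i+3}$; (2a) $q_1,q_5\to q_2,q_4$, allowed only if no other move is possible in the current position; (2b) for $i\ge2$, $q_i,q_{i+4}\to q_{i+5}$; (3a) $q_1,q_1\to q_2$; (3b) $q_2,q_2\to q_4$; (3c) $q_3,q_3\to q_2,q_4$; (3d) $q_4,q_4\to q_1,q_6$ or $q_4,q_4\to q_3,q_5$ (player's choice); (3e) $q_5,q_5\to q_1,q_7$; (3f) $q_6,q_6\to q_2,q_8$ or $q_6,q_6\to q_3,q_7$ (player's choice); (3g) for $i\ge7$, $q_i,q_i\to q_{i-5},q_{i+2}$; (4a) for $i=1,2$, $q_i,q_{i+3}\to q_{i+4}$; (4b) $q_3,q_6\to q_1,q_7$; (4c) for $i=4,5$, $q_i,q_{i+3}\to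 q_1,q_{i+4}$; (4d) $q_6,q_9\to q_2,q_{10}$; (4e) for $i\ge7$, $q_i,q_{i+3}\to q_{i-5},q_{i+4}$; (5) $q_1,q_3\to q_4$. The game ends when no move is possible. -}

module Defs where

open import Data.Nat using (ℕ; zero; suc; _+_; _*_; _∸_; _≤_; _<_)
open import Data.List using (List; []; _∷_; _++_; replicate)
open import Data.Nat.ListAction using (sum)
open import Data.List.Relation.Binary.Pointwise using (Pointwise)
open import Data.List.Relation.Binary.Permutation.Propositional using (_↭_)
open import Data.Product using (Σ; ∃; _×_; _,_)
open import Data.Sum using (_⊎_)
open import Relation.Nullary using (¬_)

-- A position is a finite multiset of Fibonacci Quilt terms q_i, recorded by
-- their indices i (as a list of naturals, taken up to permutation _↭_).
Position : Set
Position = List ℕ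

-- Rules other than (2a): OtherRule a b out  means the move  q_a , q_b → out.
data OtherRule : ℕ → ℕ → List ℕ → Set where
  r1a : OtherRule 1 2 (3 ∷ [])
  r1b : ∀ i → 2 ≤ i → OtherRule i (suc i) ((i + 3) ∷ [])
  r2b : ∀ i → 2 ≤ i → OtherRule i (i + 4) ((i + 5) ∷ [])
  r3a : OtherRule 1 1 (2 ∷ [])
  r3b : OtherRule 2 2 (4 ∷ [])
  r3c : OtherRule 3 3 (2 ∷ 4 ∷ [])
  r3d₁ : OtherRule 4 4 (1 ∷ 6 ∷ [])
  r3d₂ : OtherRule 4 4 (3 ∷ 5 ∷ [])
  r3e : OtherRule 5 5 (1 ∷ 7 ∷ [])
  r3f₁ : OtherRule 6 6 (2 ∷ 8 ∷ [])
  r3f₂ : OtherRule 6 6 (3 ∷ 7 ∷ [])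
  r3g : ∀ i → 7 ≤ i → OtherRule i i ((i ∸ 5) ∷ (i + 2) ∷ [])
  r4a₁ : OtherRule 1 4 (5 ∷ [])
  r4a₂ : OtherRule 2 5 (6 ∷ [])
  r4b : OtherRule 3 6 (1 ∷ 7 ∷ [])
  r4c₁ : OtherRule 4 7 (1 ∷ 8 ∷ [])
  r4c₂ : OtherRule 5 8 (1 ∷ 9 ∷ [])
  r4d : OtherRule 6 9 (2 ∷ 10 ∷ [])
  r4e : ∀ i → 7 ≤ i → OtherRule i (i + 3) ((i ∸ 5) ∷ (i + 4) ∷ [])
  r5 : OtherRule 1 3 (4 ∷ [])

OtherMove : Position → Position → Set
OtherMove P P' = Σ ℕ λ a → Σ ℕ λ b → Σ (List ℕ) λ out → Σ (List ℕ) λ rest →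
  OtherRule a b out × (P ↭ (a ∷ b ∷ rest)) × (P' ↭ (out ++ rest))

Move2a : Position → Position → Set
Move2a P P' = (¬ (Σ Position λ P'' → OtherMove P P'')) ×
  (Σ (List ℕ) λ rest → (P ↭ (1 ∷ 5 ∷ rest)) × (P' ↭ (2 ∷ 4 ∷ rest)))

-- Reachable n P k : position P arises in a play of the game on n
-- (starting from n copies of q_1) in which Rule (2a) has been used k times.
data Reachable (n : ℕ) : Position → ℕ → Set where
  start : Reachable n (replicate n 1) 0
  stepOther : ∀ {P P' k} → Reachable n P k → OtherMove P P' → Reachable n P' k
  step2a : ∀ {P P' k} → Reachable n P k → Move2a P P' → Reachable n P' (suc k)

-- Since there are no reals, we define the strict
-- inequality Φ(Q) < Φ(P) of real numbers in the standard constructive way: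
-- there is a common denominator N ≥ 1 and rational upper bounds u_x / N ≥ √x
-- for the elements x of Q and lower bounds l_y / N ≤ √y (l_y ≥ 0) for the
-- elements y of P with Σ u_x < Σ l_y.
ΦLt : Position → Position → Set
ΦLt Q P = Σ ℕ λ N → Σ (List ℕ) λ us → Σ (List ℕ) λ ls →
  Pointwise (λ x u → x * (suc N * suc N) ≤ u * u) Q us ×
  Pointwise (λ y l → l * l ≤ y * (suc N * suc N)) P ls ×
  (sum us < sum ls)

module Submission where

-- Part one (Φ decreases).  Φ-comparisons are invariant under permutation
-- and stable under adding the same terms to both sides (ΦLt-frame), so it
-- suffices to compare the output of each rule with its two inputs.  For the
-- finitely many closed instances this is decided by evaluating candidate
-- rational bounds at denominator 1000.  The four infinite families (1b),
-- (2b), (3g), (4e) are handled uniformly: all indices are written as j + c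
-- with 4j = s² + e (s = ⌊√(4j)⌋), √(j + c) is bracketed by its first-order
-- Taylor expansion around s/2 with denominator 16 s³, and what remains is a
-- polynomial inequality in s, proved by exhibiting its slack.
--
-- Rule (2a) needs q₁ and q₅ and is only
-- allowed when no other move is possible.  We track multiplicity functions
-- after the first (2a): first the shape After2a, then a carry travelling up
-- the large indices (Carrying).  Every move preserves one of these shapes,
-- and neither contains q₅, so (2a) never applies again.

open import Defs
open import Data.Nat using (ℕ; zero; suc; _+_; _*_; _∸_; _≤_; _<_; z≤n; s≤s; _≟_; _≤?_; _<?_; _<ᵇ_; >-nonZero)
open import Data.Nat.Properties
open import Data.Nat.DivMod using (_/_)
open import Data.Nat.ListAction using (sum)
open import Data.Nat.ListAction.Properties using (sum-++; sum-↭)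
open import Data.Nat.Tactic.RingSolver using (solve-∀)
open import Data.Bool using (Bool; true; false; if_then_else_)
open import Data.Fin using (toℕ; fromℕ<)
open import Data.Fin.Properties using (all?; toℕ-fromℕ<)
open import Data.List using (List; []; _∷_; _++_; map; length)
open import Data.List.Relation.Binary.Pointwise as Pointwise using (Pointwise; []; _∷_)
open import Data.List.Relation.Binary.Permutation.Propositional as Perm using (_↭_; ↭-refl; ↭-trans)
open import Data.List.Relation.Unary.All using (All)
open import Data.Product using (Σ; _×_; _,_; proj₁; proj₂)
open import Data.Sum using (_⊎_; inj₁; inj₂)
open import Data.Empty using (⊥; ⊥-elim)
open import Relation.Nullary using (¬_; Dec; yes; no)
open import Relation.Nullary.Decidable using (True; toWitness; _×-dec_)
open import Relation.Binary.Definitions using (tri<; tri≈; tri>)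
open import Relation.Binary.PropositionalEquality
  using (_≡_; _≢_; ≢-sym; refl; sym; trans; cong; cong₂; subst; subst₂)

≤-decided : ∀ {m n} {ok : True (m ≤? n)} → m ≤ n
≤-decided {ok = ok} = toWitness ok

<-decided : ∀ {m n} {ok : True (m <? n)} → m < n
<-decided {ok = ok} = toWitness ok

UpperBound LowerBound : ℕ → ℕ → ℕ → Set
UpperBound D x u = x * (D * D) ≤ u * u
LowerBound D y l = l * l ≤ y * (D * D)

floorSqrt : ∀ n → Σ ℕ λ s → s * s ≤ n × n < suc s * suc s
floorSqrt zero = 0 , z≤n , s≤s z≤n
floorSqrt (suc n) with floorSqrt n
... | s , s²≤n , n<[s+1]² with suc n <? suc s * suc s
...   | yes n+1<[s+1]² = s , m≤n⇒m≤1+n s²≤n , n+1<[s+1]²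
...   | no n+1≮[s+1]² = suc s , ≮⇒≥ n+1≮[s+1]² ,
        ≤-<-trans n<[s+1]² (*-mono-< (n<1+n (suc s)) (n<1+n (suc s)))

pointwise-↭ : ∀ {R : ℕ → ℕ → Set} {xs ys vs} → xs ↭ ys → Pointwise R ys vs →
  Σ (List ℕ) λ ws → Pointwise R xs ws × ws ↭ vs
pointwise-↭ Perm.refl rs = _ , rs , ↭-refl
pointwise-↭ (Perm.prep x p) (r ∷ rs) with pointwise-↭ p rs
... | ws , rs′ , ws↭ = _ , r ∷ rs′ , Perm.prep _ ws↭
pointwise-↭ (Perm.swap x y p) (r₁ ∷ r₂ ∷ rs) with pointwise-↭ p rs
... | ws , rs′ , ws↭ = _ , r₂ ∷ r₁ ∷ rs′ , Perm.swap _ _ ws↭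
pointwise-↭ (Perm.trans p q) rs with pointwise-↭ q rs
... | vs′ , rs′ , vs′↭ with pointwise-↭ p rs′
...   | ws , rs″ , ws↭ = ws , rs″ , ↭-trans ws↭ vs′↭

ΦLt-resp-↭ : ∀ {P P₀ Q Q₀} → P ↭ P₀ → Q ↭ Q₀ → ΦLt Q₀ P₀ → ΦLt Q P
ΦLt-resp-↭ P↭ Q↭ (N , us , ls , up , lo , us<ls)
  with pointwise-↭ Q↭ up | pointwise-↭ P↭ lo
... | us′ , up′ , us′↭us | ls′ , lo′ , ls′↭ls =
  N , us′ , ls′ , up′ , lo′ , subst₂ _<_ (sym (sum-↭ us′↭us)) (sym (sum-↭ ls′↭ls)) us<ls

upper-scale : ∀ {D x u} K → UpperBound D x u → UpperBound (D * K) x (u * K)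
upper-scale {D} {x} {u} K x≤u = begin
  x * ((D * K) * (D * K))  ≡⟨ regroup x D K ⟩
  x * (D * D) * (K * K)    ≤⟨ *-monoˡ-≤ (K * K) x≤u ⟩
  u * u * (K * K)          ≡⟨ regroup′ u K ⟩
  (u * K) * (u * K)        ∎
  where
  open ≤-Reasoning
  regroup : ∀ x D K → x * ((D * K) * (D * K)) ≡ x * (D * D) * (K * K)
  regroup = solve-∀
  regroup′ : ∀ u K → u * u * (K * K) ≡ (u * K) * (u * K)
  regroup′ = solve-∀

lower-scale : ∀ {D y l} K → LowerBound D y l → LowerBound (D * K) y (l * K)
lower-scale {D} {y} {l} K l≤y = begin
  (l * K) * (l * K)        ≡⟨ regroup l K ⟩
  l * l * (K * K)          ≤⟨ *-monoˡ-≤ (K * K) l≤y ⟩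
  y * (D * D) * (K * K)    ≡⟨ regroup′ y D K ⟩
  y * ((D * K) * (D * K))  ∎
  where
  open ≤-Reasoning
  regroup : ∀ l K → (l * K) * (l * K) ≡ l * l * (K * K)
  regroup = solve-∀
  regroup′ : ∀ y D K → y * (D * D) * (K * K) ≡ y * ((D * K) * (D * K))
  regroup′ = solve-∀

sum-scale : ∀ K xs → sum (map (_* K) xs) ≡ sum xs * K
sum-scale K [] = refl
sum-scale K (x ∷ xs) = trans (cong (x * K +_) (sum-scale K xs)) (sym (*-distribʳ-+ K x (sum xs)))

rootBounds : ∀ D R → Σ (List ℕ) λ ls → Σ (List ℕ) λ us →
  Pointwise (UpperBound D) R us × Pointwise (LowerBound D) R ls × sum us ≡ length R + sum ls
rootBounds D [] = [] , [] , [] , [] , refl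
rootBounds D (x ∷ R) with floorSqrt (x * (D * D)) | rootBounds D R
... | s , s²≤ , <[s+1]² | ls , us , up , lo , sums =
  s ∷ ls , suc s ∷ us , <⇒≤ <[s+1]² ∷ up , s²≤ ∷ lo , cong suc (trans (cong (s +_) sums) (exchange s (length R) (sum ls)))
  where
  exchange : ∀ a b c → a + (b + c) ≡ b + (a + c)
  exchange = solve-∀

-- Φ-comparison is stable under adding the same elements R to both sides:
-- rescale the given bounds by K = |R| + 1 and bound √y for y ∈ R by its
-- floor and ceiling at the new denominator.  The ceilings lose at most |R| < K,
-- which the strict inequality, multiplied by K, absorbs.
ΦLt-frame : ∀ {Q P} → ΦLt Q P → ∀ R → ΦLt (Q ++ R) (P ++ R)
ΦLt-frame (N , us , ls , up , lo , us<ls) R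
  with rootBounds (suc N * suc (length R)) R
... | lsR , usR , upR , loR , sumsR =
  length R + N * K , map (_* K) us ++ usR , map (_* K) ls ++ lsR ,
  Pointwise.++⁺ (scaleUp up) upR , Pointwise.++⁺ (scaleLo lo) loR , sums<
  where
  K = suc (length R)
  scaleUp : ∀ {xs vs} → Pointwise (UpperBound (suc N)) xs vs → Pointwise (UpperBound (suc N * K)) xs (map (_* K) vs)
  scaleUp [] = []
  scaleUp {x ∷ _} {v ∷ _} (b ∷ bs) = upper-scale {suc N} {x} {v} K b ∷ scaleUp bs
  scaleLo : ∀ {xs vs} → Pointwise (LowerBound (suc N)) xs vs → Pointwise (LowerBound (suc N * K)) xs (map (_* K) vs)
  scaleLo [] = []
  scaleLo {x ∷ _} {v ∷ _} (b ∷ bs) = lower-scale {suc N} {x} {v} K b ∷ scaleLo bs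
  absorb : ∀ S r z → suc (S * suc r + (r + z)) ≡ suc S * suc r + z
  absorb = solve-∀
  sums< : sum (map (_* K) us ++ usR) < sum (map (_* K) ls ++ lsR)
  sums< = begin-strict
    sum (map (_* K) us ++ usR)             ≡⟨ sum-++ (map (_* K) us) usR ⟩
    sum (map (_* K) us) + sum usR          ≡⟨ cong₂ _+_ (sum-scale K us) sumsR ⟩
    sum us * K + (length R + sum lsR)      <⟨ ≤-reflexive (absorb (sum us) (length R) (sum lsR)) ⟩
    suc (sum us) * K + sum lsR             ≤⟨ +-monoˡ-≤ (sum lsR) (*-monoˡ-≤ K us<ls) ⟩
    sum ls * K + sum lsR                   ≡⟨ cong (_+ sum lsR) (sym (sum-scale K ls)) ⟩
    sum (map (_* K) ls) + sum lsR          ≡⟨ sum-++ (map (_* K) ls) lsR ⟨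
    sum (map (_* K) ls ++ lsR)             ∎
    where open ≤-Reasoning

-- A fast integer square root by Newton's iteration (with enough fuel for
-- the numbers below).  It is not verified: its results only serve as
-- candidate bounds, which are checked afterwards.
newtonSqrt : ℕ → ℕ → ℕ → ℕ
newtonSqrt zero n x = x
newtonSqrt (suc fuel) n zero = zero
newtonSqrt (suc fuel) n (suc x) =
  let y = (suc x + n / suc x) / 2 in
  if y <ᵇ suc x then newtonSqrt fuel n y else suc x

isqrt : ℕ → ℕ
isqrt n = newtonSqrt 64 n n

-- Candidate bounds at denominator 1000: ⌈1000 √x⌉ and ⌊1000 √y⌋ (if isqrt is right).
candidateUpper candidateLower : ℕ → ℕ
candidateUpper x = suc (isqrt (x * (1000 * 1000)))
candidateLower y = isqrt (y * (1000 * 1000))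

CandidatesWork : List ℕ → List ℕ → Set
CandidatesWork Q P =
  Pointwise (UpperBound 1000) Q (map candidateUpper Q) ×
  Pointwise (LowerBound 1000) P (map candidateLower P) ×
  sum (map candidateUpper Q) < sum (map candidateLower P)

candidatesWork? : ∀ Q P → Dec (CandidatesWork Q P)
candidatesWork? Q P =
  Pointwise.decidable (λ x u → x * (1000 * 1000) ≤? u * u) Q (map candidateUpper Q) ×-dec
  Pointwise.decidable (λ y l → l * l ≤? y * (1000 * 1000)) P (map candidateLower P) ×-dec
  (sum (map candidateUpper Q) <? sum (map candidateLower P))

ΦLt-by-computation : ∀ {Q P} → CandidatesWork Q P → ΦLt Q P
ΦLt-by-computation {Q} {P} (up , lo , sums<) = 999 , map candidateUpper Q , map candidateLower P , up , lo , sums<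

ΦLt-decided : ∀ {Q P} {ok : True (candidatesWork? Q P)} → ΦLt Q P
ΦLt-decided {ok = ok} = ΦLt-by-computation (toWitness ok)

ΦLt-family : ∀ (ins outs : ℕ → List ℕ) lo hi →
  {_ : True (all? {hi ∸ lo} (λ k → candidatesWork? (outs (lo + toℕ k)) (ins (lo + toℕ k))))} →
  (∀ i → hi ≤ i → ΦLt (outs i) (ins i)) → ∀ i → lo ≤ i → ΦLt (outs i) (ins i)
ΦLt-family ins outs lo hi {ok} large i lo≤i with hi ≤? i
... | yes hi≤i = large i hi≤i
... | no i≱hi = subst Instance (m+[n∸m]≡n lo≤i)
      (subst (λ k → Instance (lo + k)) (toℕ-fromℕ< k<) (ΦLt-by-computation (toWitness ok (fromℕ< k<))))
  where
  Instance : ℕ → Set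
  Instance m = ΦLt (outs m) (ins m)
  k< : i ∸ lo < hi ∸ lo
  k< = ∸-monoˡ-< (≰⇒> i≱hi) lo≤i

-- If 4x = s² + w with s ≥ 1, then √x = √(s² + w)/2 and the
-- first-order expansion gives, with denominator D = 16 s³ and U = 8 s⁴ + 4 s² w,
--   (U − w²)/D ≤ √x ≤ U/D      (the lower bound needs w ≤ 8 s²).
taylorDen : ℕ → ℕ
taylorDen s = 16 * (s * (s * s))

taylorUp : ℕ → ℕ → ℕ
taylorUp s w = 8 * (s * s * (s * s)) + 4 * (s * s) * w

taylor-square : ∀ s w →
  4 * ((8 * (s * s * (s * s)) + 4 * (s * s) * w) * (8 * (s * s * (s * s)) + 4 * (s * s) * w))
  ≡ (s * s + w) * (16 * (s * (s * s)) * (16 * (s * (s * s)))) + 64 * (s * s * (s * s)) * (w * w)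
taylor-square = solve-∀

taylor-upper : ∀ x s w → 4 * x ≡ s * s + w → UpperBound (taylorDen s) x (taylorUp s w)
taylor-upper x s w 4x≡ = *-cancelˡ-≤ 4 (begin
  4 * (x * (D * D))                   ≡⟨ *-assoc 4 x (D * D) ⟨
  4 * x * (D * D)                     ≡⟨ cong (_* (D * D)) 4x≡ ⟩
  (s * s + w) * (D * D)               ≤⟨ m≤m+n _ _ ⟩
  (s * s + w) * (D * D) + 64 * (s * s * (s * s)) * (w * w)  ≡⟨ taylor-square s w ⟨
  4 * (taylorUp s w * taylorUp s w)   ∎)
  where
  open ≤-Reasoning
  D = taylorDen s

taylor-lower : ∀ x s w L → 4 * x ≡ s * s + w → w ≤ 8 * (s * s) → L + w * w ≡ taylorUp s w →
  LowerBound (taylorDen s) x L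
taylor-lower x s w L 4x≡ w≤8s² L+w²≡U = *-cancelˡ-≤ 4 (+-cancelʳ-≤ E (4 * (L * L)) (4 * (x * (D * D))) (begin
  4 * (L * L) + E                                  ≤⟨ +-monoʳ-≤ (4 * (L * L)) (m≤m+n E (4 * (w * w * w) * z)) ⟩
  4 * (L * L) + (E + 4 * (w * w * w) * z)          ≡⟨ cong (4 * (L * L) +_) cross-term ⟨
  4 * (L * L) + (8 * L * (w * w) + 4 * (w * w * (w * w)))  ≡⟨ expand L (w * w) ⟩
  4 * ((L + w * w) * (L + w * w))                  ≡⟨ cong (λ v → 4 * (v * v)) L+w²≡U ⟩
  4 * (U * U)                                      ≡⟨ taylor-square s w ⟩
  (s * s + w) * (D * D) + E                        ≡⟨ cong (λ v → v * (D * D) + E) 4x≡ ⟨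
  4 * x * (D * D) + E                              ≡⟨ cong (_+ E) (*-assoc 4 x (D * D)) ⟩
  4 * (x * (D * D)) + E                            ∎))
  where
  open ≤-Reasoning
  D = taylorDen s
  U = taylorUp s w
  E = 64 * (s * s * (s * s)) * (w * w)
  z = 8 * (s * s) ∸ w
  expand : ∀ L v → 4 * (L * L) + (8 * L * v + 4 * (v * v)) ≡ 4 * ((L + v) * (L + v))
  expand = solve-∀
  cross-term : 8 * L * (w * w) + 4 * (w * w * (w * w)) ≡ E + 4 * (w * w * w) * z
  cross-term = +-cancelʳ-≡ (4 * (w * w * (w * w))) _ _ (begin-equality
    8 * L * (w * w) + 4 * (w * w * (w * w)) + 4 * (w * w * (w * w))  ≡⟨ collect L w ⟩
    8 * (L + w * w) * (w * w)                       ≡⟨ cong (λ v → 8 * v * (w * w)) L+w²≡U ⟩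
    8 * U * (w * w)                                 ≡⟨ spread s w ⟩
    E + 4 * (w * w * w) * (8 * (s * s))             ≡⟨ cong (λ v → E + 4 * (w * w * w) * v) (m∸n+n≡m w≤8s²) ⟨
    E + 4 * (w * w * w) * (z + w)                   ≡⟨ split E w z ⟩
    E + 4 * (w * w * w) * z + 4 * (w * w * (w * w)) ∎)
    where
    collect : ∀ L w → 8 * L * (w * w) + 4 * (w * w * (w * w)) + 4 * (w * w * (w * w)) ≡ 8 * (L + w * w) * (w * w)
    collect = solve-∀
    spread : ∀ s w → 8 * (8 * (s * s * (s * s)) + 4 * (s * s) * w) * (w * w)
                     ≡ 64 * (s * s * (s * s)) * (w * w) + 4 * (w * w * w) * (8 * (s * s))
    spread = solve-∀
    split : ∀ E w z → E + 4 * (w * w * w) * (z + w) ≡ E + 4 * (w * w * w) * z + 4 * (w * w * (w * w))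
    split = solve-∀

record SquareSplit (n : ℕ) : Set where
  field
    root excess : ℕ
    split : root * root + excess ≡ n
    excess≤ : excess ≤ 2 * root
    maximal : ∀ r → r * r ≤ n → r ≤ root

squareSplit : ∀ n → SquareSplit n
squareSplit n with floorSqrt n
... | s , s²≤n , n<[s+1]² = record
  { root = s ; excess = n ∸ s * s ; split = m+[n∸m]≡n s²≤n
  ; excess≤ = +-cancelˡ-≤ (s * s) _ _ (≤-pred (begin-strict
      s * s + (n ∸ s * s)   ≡⟨ m+[n∸m]≡n s²≤n ⟩
      n                     <⟨ n<[s+1]² ⟩
      suc s * suc s         ≡⟨ square-suc s ⟩
      suc (s * s + 2 * s)   ∎))
  ; maximal = λ r r²≤n → ≮⇒≥ (λ s<r → <⇒≱ n<[s+1]² (≤-trans (*-mono-≤ s<r s<r) r²≤n)) }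
  where
  open ≤-Reasoning
  square-suc : ∀ s → suc s * suc s ≡ suc (s * s + 2 * s)
  square-suc = solve-∀

root-from : ∀ s₀ j₀ {j} → s₀ * s₀ ≤ 4 * j₀ → j₀ ≤ j → s₀ ≤ SquareSplit.root (squareSplit (4 * j))
root-from s₀ j₀ {j} s₀²≤ j₀≤j = SquareSplit.maximal (squareSplit (4 * j)) s₀ (≤-trans s₀²≤ (*-monoʳ-≤ 4 j₀≤j))

-- A polynomial inequality for all s ≥ s₀, from an identity in t = s − s₀
-- exhibiting the (coefficientwise nonnegative) slack.
fromSlack : ∀ {s₀ s} (lhs rhs slack : ℕ → ℕ) →
  (∀ t → rhs (s₀ + t) ≡ lhs (s₀ + t) + slack t) → s₀ ≤ s → lhs s ≤ rhs s
fromSlack lhs rhs slack identity s₀≤s with m≤n⇒∃[o]m+o≡n s₀≤s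
... | t , refl = ≤-trans (m≤m+n _ (slack t)) (≤-reflexive (sym (identity t)))

-- Two elements a, b against a list outs, all expanded around the same s:
-- Φ(outs) < √a + √b once the upper bounds for outs, together with the
-- losses wa², wb² of the lower bounds for a, b, stay below Ua + Ub.
taylorΦ : ∀ s {a b} wa wb {outs} ws → 1 ≤ s →
  4 * a ≡ s * s + wa → 4 * b ≡ s * s + wb → wa ≤ 4 * (s * s) → wb ≤ 4 * (s * s) →
  Pointwise (λ o w → 4 * o ≡ s * s + w) outs ws →
  1 + sum (map (taylorUp s) ws) + (wa * wa + wb * wb) ≤ taylorUp s wa + taylorUp s wb →
  ΦLt outs (a ∷ b ∷ [])
taylorΦ (suc r) {a} {b} wa wb ws _ 4a≡ 4b≡ wa≤ wb≤ outs≡ fits =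
  taylorDen s ∸ 1 , map (taylorUp s) ws , La ∷ Lb ∷ [] , uppers outs≡ ,
  taylor-lower a s wa La 4a≡ (≤-trans wa≤ 4s²≤8s²) (m∸n+n≡m (loss≤ wa≤)) ∷
  taylor-lower b s wb Lb 4b≡ (≤-trans wb≤ 4s²≤8s²) (m∸n+n≡m (loss≤ wb≤)) ∷ [] ,
  +-cancelʳ-≤ (wa * wa + wb * wb) _ _ (begin
    1 + sum (map (taylorUp s) ws) + (wa * wa + wb * wb)  ≤⟨ fits ⟩
    taylorUp s wa + taylorUp s wb                        ≡⟨ cong₂ _+_ (m∸n+n≡m (loss≤ wa≤)) (m∸n+n≡m (loss≤ wb≤)) ⟨
    (La + wa * wa) + (Lb + wb * wb)                      ≡⟨ regroup La Lb (wa * wa) (wb * wb) ⟩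
    (La + (Lb + 0)) + (wa * wa + wb * wb)                ∎)
  where
  open ≤-Reasoning
  s = suc r
  La = taylorUp s wa ∸ wa * wa
  Lb = taylorUp s wb ∸ wb * wb
  4s²≤8s² : 4 * (s * s) ≤ 8 * (s * s)
  4s²≤8s² = *-monoˡ-≤ (s * s) {4} {8} (s≤s (s≤s (s≤s (s≤s z≤n))))
  loss≤ : ∀ {w} → w ≤ 4 * (s * s) → w * w ≤ taylorUp s w
  loss≤ {w} w≤ = ≤-trans (*-monoˡ-≤ w w≤) (m≤n+m (4 * (s * s) * w) (8 * (s * s * (s * s))))
  uppers : ∀ {os vs} → Pointwise (λ o w → 4 * o ≡ s * s + w) os vs →
    Pointwise (UpperBound (taylorDen s)) os (map (taylorUp s) vs)
  uppers [] = []
  uppers {o ∷ _} {v ∷ _} (4o≡ ∷ rest) = taylor-upper o s v 4o≡ ∷ uppers rest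
  regroup : ∀ a b c d → (a + c) + (b + d) ≡ (a + (b + 0)) + (c + d)
  regroup = solve-∀

offset-split : ∀ j s e c → s * s + e ≡ 4 * j → 4 * (c + j) ≡ s * s + (4 * c + e)
offset-split j s e c split = begin-equality
  4 * (c + j)          ≡⟨ *-distribˡ-+ 4 c j ⟩
  4 * c + 4 * j        ≡⟨ cong (4 * c +_) split ⟨
  4 * c + (s * s + e)  ≡⟨ exchange (4 * c) (s * s) e ⟩
  s * s + (4 * c + e)  ∎
  where
  open ≤-Reasoning
  exchange : ∀ a b c → a + (b + c) ≡ b + (a + c)
  exchange = solve-∀

offset-bound : ∀ s e c → 1 ≤ s → 2 * c ≤ s * s → e ≤ 2 * s → 4 * c + e ≤ 4 * (s * s)
offset-bound s e c 1≤s 2c≤s² e≤2s = begin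
  4 * c + e              ≤⟨ +-mono-≤ (≤-reflexive (*-assoc 2 2 c)) (≤-trans e≤2s (*-monoʳ-≤ 2 (m≤m*n s s {{>-nonZero 1≤s}}))) ⟩
  2 * (2 * c) + 2 * (s * s)  ≤⟨ +-monoˡ-≤ (2 * (s * s)) (*-monoʳ-≤ 2 2c≤s²) ⟩
  2 * (s * s) + 2 * (s * s)  ≡⟨ double (s * s) ⟩
  4 * (s * s)            ∎
  where
  open ≤-Reasoning
  double : ∀ x → 2 * x + 2 * x ≡ 4 * x
  double = solve-∀

inputLoss : ℕ → ℕ → ℕ → ℕ
inputLoss ca cb s = 1 + (4 * ca + 2 * s) * (4 * ca + 2 * s) + (4 * cb + 2 * s) * (4 * cb + 2 * s)

inputLoss-bound : ∀ s e ca cb → e ≤ 2 * s →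
  1 + (4 * ca + e) * (4 * ca + e) + (4 * cb + e) * (4 * cb + e) ≤ inputLoss ca cb s
inputLoss-bound s e ca cb e≤ = +-mono-≤ (+-monoʳ-≤ 1 (square-mono (+-monoʳ-≤ (4 * ca) e≤))) (square-mono (+-monoʳ-≤ (4 * cb) e≤))
  where
  square-mono : ∀ {x y} → x ≤ y → x * x ≤ y * y
  square-mono x≤y = *-mono-≤ x≤y x≤y

-- Merging j + ca and j + cb into j + co, where co = ca + cb + k:
-- the upper bounds lose 8 s⁴ + 4 s² e − 16 s² k, which must cover the input losses.
mergeΦ : ∀ {j s e} ca cb co k → 1 ≤ s → s * s + e ≡ 4 * j → e ≤ 2 * s →
  co ≡ ca + cb + k → 2 * ca ≤ s * s → 2 * cb ≤ s * s →
  inputLoss ca cb s + 16 * (s * s) * k ≤ 8 * (s * s * (s * s)) →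
  ΦLt (co + j ∷ []) (ca + j ∷ cb + j ∷ [])
mergeΦ {j} {s} {e} ca cb co k 1≤s split e≤ refl ca≤ cb≤ covered =
  taylorΦ s wa wb (wo ∷ []) 1≤s (offset-split j s e ca split) (offset-split j s e cb split)
    (offset-bound s e ca 1≤s ca≤ e≤) (offset-bound s e cb 1≤s cb≤ e≤) (offset-split j s e co split ∷ []) fits
  where
  open ≤-Reasoning
  wa = 4 * ca + e
  wb = 4 * cb + e
  wo = 4 * co + e
  U = taylorUp s
  linear : ∀ ca cb k s e →
    (8 * (s * s * (s * s)) + 4 * (s * s) * (4 * ca + e)) + (8 * (s * s * (s * s)) + 4 * (s * s) * (4 * cb + e)) + 16 * (s * s) * k
    ≡ (8 * (s * s * (s * s)) + 4 * (s * s) * (4 * (ca + cb + k) + e)) + (8 * (s * s * (s * s)) + 4 * (s * s) * e)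
  linear = solve-∀
  shuffle : ∀ x p q m → 1 + (x + 0) + (p + q) + m ≡ x + (1 + p + q + m)
  shuffle = solve-∀
  fits : 1 + (U wo + 0) + (wa * wa + wb * wb) ≤ U wa + U wb
  fits = +-cancelʳ-≤ (16 * (s * s) * k) _ _ (begin
    1 + (U wo + 0) + (wa * wa + wb * wb) + 16 * (s * s) * k  ≡⟨ shuffle (U wo) (wa * wa) (wb * wb) _ ⟩
    U wo + (1 + wa * wa + wb * wb + 16 * (s * s) * k)      ≤⟨ +-monoʳ-≤ (U wo) (+-monoˡ-≤ _ (inputLoss-bound s e ca cb e≤)) ⟩
    U wo + (inputLoss ca cb s + 16 * (s * s) * k)          ≤⟨ +-monoʳ-≤ (U wo) covered ⟩
    U wo + 8 * (s * s * (s * s))                           ≤⟨ +-monoʳ-≤ (U wo) (m≤m+n _ _) ⟩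
    U wo + (8 * (s * s * (s * s)) + 4 * (s * s) * e)       ≡⟨ linear ca cb k s e ⟨
    U wa + U wb + 16 * (s * s) * k                         ∎)

-- Exchanging j + ca, j + cb for j + c₁, j + c₂, where ca + cb = c₁ + c₂ + Δ:
-- the upper bounds gain 16 s² Δ, which must cover the input losses.
exchangeΦ : ∀ {j s e} ca cb c₁ c₂ Δ → 1 ≤ s → s * s + e ≡ 4 * j → e ≤ 2 * s →
  ca + cb ≡ c₁ + c₂ + Δ → 2 * ca ≤ s * s → 2 * cb ≤ s * s →
  inputLoss ca cb s ≤ 16 * (s * s) * Δ →
  ΦLt (c₁ + j ∷ c₂ + j ∷ []) (ca + j ∷ cb + j ∷ [])
exchangeΦ {j} {s} {e} ca cb c₁ c₂ Δ 1≤s split e≤ balance ca≤ cb≤ covered =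
  taylorΦ s wa wb (w₁ ∷ w₂ ∷ []) 1≤s (offset-split j s e ca split) (offset-split j s e cb split)
    (offset-bound s e ca 1≤s ca≤ e≤) (offset-bound s e cb 1≤s cb≤ e≤)
    (offset-split j s e c₁ split ∷ offset-split j s e c₂ split ∷ []) fits
  where
  open ≤-Reasoning
  wa = 4 * ca + e
  wb = 4 * cb + e
  w₁ = 4 * c₁ + e
  w₂ = 4 * c₂ + e
  U = taylorUp s
  linear : ∀ c₁ c₂ Δ s e →
    (8 * (s * s * (s * s)) + 4 * (s * s) * (4 * c₁ + e)) + (8 * (s * s * (s * s)) + 4 * (s * s) * (4 * c₂ + e)) + 16 * (s * s) * Δ
    ≡ 16 * (s * s * (s * s)) + 4 * (s * s) * (4 * (c₁ + c₂ + Δ) + e + e)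
  linear = solve-∀
  linear′ : ∀ ca cb s e →
    (8 * (s * s * (s * s)) + 4 * (s * s) * (4 * ca + e)) + (8 * (s * s * (s * s)) + 4 * (s * s) * (4 * cb + e))
    ≡ 16 * (s * s * (s * s)) + 4 * (s * s) * (4 * (ca + cb) + e + e)
  linear′ = solve-∀
  shuffle : ∀ x y p q → 1 + (x + (y + 0)) + (p + q) ≡ (x + y) + (1 + p + q)
  shuffle = solve-∀
  fits : 1 + (U w₁ + (U w₂ + 0)) + (wa * wa + wb * wb) ≤ U wa + U wb
  fits = begin
    1 + (U w₁ + (U w₂ + 0)) + (wa * wa + wb * wb)  ≡⟨ shuffle (U w₁) (U w₂) (wa * wa) (wb * wb) ⟩
    (U w₁ + U w₂) + (1 + wa * wa + wb * wb)        ≤⟨ +-monoʳ-≤ (U w₁ + U w₂) (inputLoss-bound s e ca cb e≤) ⟩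
    (U w₁ + U w₂) + inputLoss ca cb s              ≤⟨ +-monoʳ-≤ (U w₁ + U w₂) covered ⟩
    (U w₁ + U w₂) + 16 * (s * s) * Δ               ≡⟨ linear c₁ c₂ Δ s e ⟩
    16 * (s * s * (s * s)) + 4 * (s * s) * (4 * (c₁ + c₂ + Δ) + e + e)
      ≡⟨ cong (λ m → 16 * (s * s * (s * s)) + 4 * (s * s) * (4 * m + e + e)) balance ⟨
    16 * (s * s * (s * s)) + 4 * (s * s) * (4 * (ca + cb) + e + e)      ≡⟨ linear′ ca cb s e ⟨
    U wa + U wb                                    ∎

small-offset : ∀ c {s₀ s} → 2 * c ≤ s₀ * s₀ → s₀ ≤ s → 2 * c ≤ s * s
small-offset c 2c≤ s₀≤s = ≤-trans 2c≤ (*-mono-≤ s₀≤s s₀≤s)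

shifted : ∀ {P : ℕ → Set} c j₀ → (∀ j → j₀ ≤ j → P (c + j)) → ∀ i → c + j₀ ≤ i → P i
shifted c j₀ prove i c+j₀≤i with m≤n⇒∃[o]m+o≡n (≤-trans (m≤m+n c j₀) c+j₀≤i)
... | j , refl = prove j (+-cancelˡ-≤ c j₀ j c+j₀≤i)

quartic : ℕ → ℕ
quartic s = 8 * (s * s * (s * s))

rule1b-slack : ∀ t → 8 * ((3 + t) * (3 + t) * ((3 + t) * (3 + t)))
    ≡ 1 + (4 * 0 + 2 * (3 + t)) * (4 * 0 + 2 * (3 + t)) + (4 * 1 + 2 * (3 + t)) * (4 * 1 + 2 * (3 + t)) + 16 * ((3 + t) * (3 + t)) * 2
      + (8 * (t * t * (t * t)) + 96 * (t * t * t) + 392 * (t * t) + 608 * t + 223)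
rule1b-slack = solve-∀

rule1b-large : ∀ i → 3 ≤ i → ΦLt (i + 3 ∷ []) (i ∷ suc i ∷ [])
rule1b-large i 3≤i = subst (λ m → ΦLt (m ∷ []) (i ∷ suc i ∷ [])) (+-comm 3 i)
  (mergeΦ 0 1 3 2 (≤-trans ≤-decided s≥3) split excess≤ refl z≤n (small-offset 1 ≤-decided s≥3)
    (fromSlack {s = root} (λ s → inputLoss 0 1 s + 16 * (s * s) * 2) quartic _ rule1b-slack s≥3))
  where
  open SquareSplit (squareSplit (4 * i))
  s≥3 : 3 ≤ root
  s≥3 = root-from 3 3 ≤-decided 3≤i

rule2b-slack : ∀ t → 8 * ((4 + t) * (4 + t) * ((4 + t) * (4 + t)))
    ≡ 1 + (4 * 0 + 2 * (4 + t)) * (4 * 0 + 2 * (4 + t)) + (4 * 4 + 2 * (4 + t)) * (4 * 4 + 2 * (4 + t)) + 16 * ((4 + t) * (4 + t)) * 1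
      + (8 * (t * t * (t * t)) + 128 * (t * t * t) + 744 * (t * t) + 1792 * t + 1151)
rule2b-slack = solve-∀

rule2b-large : ∀ i → 4 ≤ i → ΦLt (i + 5 ∷ []) (i ∷ i + 4 ∷ [])
rule2b-large i 4≤i = subst₂ (λ m n → ΦLt (m ∷ []) (i ∷ n ∷ [])) (+-comm 5 i) (+-comm 4 i)
  (mergeΦ 0 4 5 1 (≤-trans ≤-decided s≥4) split excess≤ refl z≤n (small-offset 4 ≤-decided s≥4)
    (fromSlack {s = root} (λ s → inputLoss 0 4 s + 16 * (s * s) * 1) quartic _ rule2b-slack s≥4))
  where
  open SquareSplit (squareSplit (4 * i))
  s≥4 : 4 ≤ root
  s≥4 = root-from 4 4 ≤-decided 4≤i

rule3g-slack : ∀ t → 16 * ((7 + t) * (7 + t)) * 3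
    ≡ 1 + (4 * 5 + 2 * (7 + t)) * (4 * 5 + 2 * (7 + t)) + (4 * 5 + 2 * (7 + t)) * (4 * 5 + 2 * (7 + t))
      + (40 * (t * t) + 400 * t + 39)
rule3g-slack = solve-∀

rule3g-large : ∀ j → 13 ≤ j → ΦLt (j ∷ 5 + j + 2 ∷ []) (5 + j ∷ 5 + j ∷ [])
rule3g-large j 13≤j = subst (λ m → ΦLt (j ∷ m ∷ []) (5 + j ∷ 5 + j ∷ [])) (sym (+-comm (5 + j) 2))
  (exchangeΦ 5 5 0 7 3 (≤-trans ≤-decided s≥7) split excess≤ refl
    (small-offset 5 ≤-decided s≥7) (small-offset 5 ≤-decided s≥7)
    (fromSlack {s = root} (inputLoss 5 5) (λ s → 16 * (s * s) * 3) _ rule3g-slack s≥7))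
  where
  open SquareSplit (squareSplit (4 * j))
  s≥7 : 7 ≤ root
  s≥7 = root-from 7 13 ≤-decided 13≤j

rule4e-slack : ∀ t → 16 * ((8 + t) * (8 + t)) * 4
    ≡ 1 + (4 * 5 + 2 * (8 + t)) * (4 * 5 + 2 * (8 + t)) + (4 * 8 + 2 * (8 + t)) * (4 * 8 + 2 * (8 + t))
      + (56 * (t * t) + 688 * t + 495)
rule4e-slack = solve-∀

rule4e-large : ∀ j → 16 ≤ j → ΦLt (j ∷ 5 + j + 4 ∷ []) (5 + j ∷ 5 + j + 3 ∷ [])
rule4e-large j 16≤j = subst₂ (λ m n → ΦLt (j ∷ m ∷ []) (5 + j ∷ n ∷ [])) (sym (+-comm (5 + j) 4)) (sym (+-comm (5 + j) 3))
  (exchangeΦ 5 8 0 9 4 (≤-trans ≤-decided s≥8) split excess≤ refl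
    (small-offset 5 ≤-decided s≥8) (small-offset 8 ≤-decided s≥8)
    (fromSlack {s = root} (inputLoss 5 8) (λ s → 16 * (s * s) * 4) _ rule4e-slack s≥8))
  where
  open SquareSplit (squareSplit (4 * j))
  s≥8 : 8 ≤ root
  s≥8 = root-from 8 16 ≤-decided 16≤j

ruleΦ : ∀ {a b out} → OtherRule a b out → ΦLt out (a ∷ b ∷ [])
ruleΦ r1a = ΦLt-decided
ruleΦ (r1b i 2≤i) = ΦLt-family (λ i → i ∷ suc i ∷ []) (λ i → i + 3 ∷ []) 2 3 rule1b-large i 2≤i
ruleΦ (r2b i 2≤i) = ΦLt-family (λ i → i ∷ i + 4 ∷ []) (λ i → i + 5 ∷ []) 2 4 rule2b-large i 2≤i
ruleΦ r3a = ΦLt-decided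
ruleΦ r3b = ΦLt-decided
ruleΦ r3c = ΦLt-decided
ruleΦ r3d₁ = ΦLt-decided
ruleΦ r3d₂ = ΦLt-decided
ruleΦ r3e = ΦLt-decided
ruleΦ r3f₁ = ΦLt-decided
ruleΦ r3f₂ = ΦLt-decided
ruleΦ (r3g i 7≤i) = ΦLt-family (λ i → i ∷ i ∷ []) (λ i → i ∸ 5 ∷ i + 2 ∷ []) 7 18
  (shifted 5 13 rule3g-large) i 7≤i
ruleΦ r4a₁ = ΦLt-decided
ruleΦ r4a₂ = ΦLt-decided
ruleΦ r4b = ΦLt-decided
ruleΦ r4c₁ = ΦLt-decided
ruleΦ r4c₂ = ΦLt-decided
ruleΦ r4d = ΦLt-decided
ruleΦ (r4e i 7≤i) = ΦLt-family (λ i → i ∷ i + 3 ∷ []) (λ i → i ∸ 5 ∷ i + 4 ∷ []) 7 21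
  (shifted 5 16 rule4e-large) i 7≤i
ruleΦ r5 = ΦLt-decided

Φ-decreases : ∀ {P P'} → OtherMove P P' → ΦLt P' P
Φ-decreases (a , b , out , rest , rule , P↭ , P'↭) = ΦLt-resp-↭ P↭ P'↭ (ΦLt-frame (ruleΦ rule) rest)

δ : ℕ → ℕ → ℕ
δ y x with y ≟ x
... | yes _ = 1
... | no _ = 0

δ-same : ∀ x → δ x x ≡ 1
δ-same x with x ≟ x
... | yes _ = refl
... | no x≢x = ⊥-elim (x≢x refl)

δ-diff : ∀ {y x} → y ≢ x → δ y x ≡ 0
δ-diff {y} {x} y≢x with y ≟ x
... | yes y≡x = ⊥-elim (y≢x y≡x)
... | no _ = refl

mult : List ℕ → ℕ → ℕ
mult [] x = 0
mult (y ∷ ys) x = δ y x + mult ys x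

mult-↭ : ∀ {xs ys} → xs ↭ ys → ∀ x → mult xs x ≡ mult ys x
mult-↭ Perm.refl x = refl
mult-↭ (Perm.prep y p) x = cong (δ y x +_) (mult-↭ p x)
mult-↭ (Perm.swap y z p) x = trans (cong (λ m → δ y x + (δ z x + m)) (mult-↭ p x)) (exchange (δ y x) (δ z x) _)
  where
  exchange : ∀ a b m → a + (b + m) ≡ b + (a + m)
  exchange a b m = trans (sym (+-assoc a b m)) (trans (cong (_+ m) (+-comm a b)) (+-assoc b a m))
mult-↭ (Perm.trans p q) x = trans (mult-↭ p x) (mult-↭ q x)

mult-++ : ∀ xs ys x → mult (xs ++ ys) x ≡ mult xs x + mult ys x
mult-++ [] ys x = refl
mult-++ (y ∷ xs) ys x = trans (cong (δ y x +_) (mult-++ xs ys x)) (sym (+-assoc (δ y x) (mult xs x) (mult ys x)))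

extract : ∀ xs x → 1 ≤ mult xs x → Σ (List ℕ) λ ys → xs ↭ x ∷ ys
extract [] x ()
extract (y ∷ ys) x present with y ≟ x
... | yes refl = ys , ↭-refl
... | no _ with extract ys x present
...   | zs , ys↭ = y ∷ zs , ↭-trans (Perm.prep y ys↭) (Perm.swap y x ↭-refl)

mult₁-other : ∀ o x → o ≢ x → mult (o ∷ []) x ≡ 0
mult₁-other o x o≢x = cong (_+ 0) (δ-diff o≢x)

mult₁-self : ∀ o → mult (o ∷ []) o ≡ 1
mult₁-self o = cong (_+ 0) (δ-same o)

mult₂-other : ∀ o p x → o ≢ x → p ≢ x → mult (o ∷ p ∷ []) x ≡ 0
mult₂-other o p x o≢x p≢x = cong₂ _+_ (δ-diff o≢x) (cong (_+ 0) (δ-diff p≢x))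

mult₂-first : ∀ o p → o ≢ p → mult (o ∷ p ∷ []) o ≡ 1
mult₂-first o p o≢p = cong₂ _+_ (δ-same o) (cong (_+ 0) (δ-diff (λ p≡o → o≢p (sym p≡o))))

mult₂-second : ∀ o p → o ≢ p → mult (o ∷ p ∷ []) p ≡ 1
mult₂-second o p o≢p = cong₂ _+_ (δ-diff o≢p) (cong (_+ 0) (δ-same p))

rule-left≥1 : ∀ {a b out} → OtherRule a b out → 1 ≤ a
rule-left≥1 r1a = s≤s z≤n
rule-left≥1 (r1b i 2≤i) = ≤-trans (s≤s z≤n) 2≤i
rule-left≥1 (r2b i 2≤i) = ≤-trans (s≤s z≤n) 2≤i
rule-left≥1 r3a = s≤s z≤n
rule-left≥1 r3b = s≤s z≤n
rule-left≥1 r3c = s≤s z≤n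
rule-left≥1 r3d₁ = s≤s z≤n
rule-left≥1 r3d₂ = s≤s z≤n
rule-left≥1 r3e = s≤s z≤n
rule-left≥1 r3f₁ = s≤s z≤n
rule-left≥1 r3f₂ = s≤s z≤n
rule-left≥1 (r3g i 7≤i) = ≤-trans (s≤s z≤n) 7≤i
rule-left≥1 r4a₁ = s≤s z≤n
rule-left≥1 r4a₂ = s≤s z≤n
rule-left≥1 r4b = s≤s z≤n
rule-left≥1 r4c₁ = s≤s z≤n
rule-left≥1 r4c₂ = s≤s z≤n
rule-left≥1 r4d = s≤s z≤n
rule-left≥1 (r4e i 7≤i) = ≤-trans (s≤s z≤n) 7≤i
rule-left≥1 r5 = s≤s z≤n

LargeRule : ℕ → ℕ → List ℕ → Set
LargeRule a b out = (b ≡ a) ⊎ (b ≡ suc a × out ≡ (a + 3) ∷ []) ⊎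
  (b ≡ a + 3 × out ≡ (a ∸ 5) ∷ (a + 4) ∷ []) ⊎ (b ≡ a + 4 × out ≡ (a + 5) ∷ [])

large-rule : ∀ {a b out} → OtherRule a b out → 7 ≤ a → LargeRule a b out
large-rule (r1b i _) _ = inj₂ (inj₁ (refl , refl))
large-rule (r2b i _) _ = inj₂ (inj₂ (inj₂ (refl , refl)))
large-rule (r3g i _) _ = inj₁ refl
large-rule (r4e i _) _ = inj₂ (inj₂ (inj₁ (refl , refl)))
large-rule r1a 7≤a = ⊥-elim (<⇒≱ <-decided 7≤a)
large-rule r3a 7≤a = ⊥-elim (<⇒≱ <-decided 7≤a)
large-rule r3b 7≤a = ⊥-elim (<⇒≱ <-decided 7≤a)
large-rule r3c 7≤a = ⊥-elim (<⇒≱ <-decided 7≤a)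
large-rule r3d₁ 7≤a = ⊥-elim (<⇒≱ <-decided 7≤a)
large-rule r3d₂ 7≤a = ⊥-elim (<⇒≱ <-decided 7≤a)
large-rule r3e 7≤a = ⊥-elim (<⇒≱ <-decided 7≤a)
large-rule r3f₁ 7≤a = ⊥-elim (<⇒≱ <-decided 7≤a)
large-rule r3f₂ 7≤a = ⊥-elim (<⇒≱ <-decided 7≤a)
large-rule r4a₁ 7≤a = ⊥-elim (<⇒≱ <-decided 7≤a)
large-rule r4a₂ 7≤a = ⊥-elim (<⇒≱ <-decided 7≤a)
large-rule r4b 7≤a = ⊥-elim (<⇒≱ <-decided 7≤a)
large-rule r4c₁ 7≤a = ⊥-elim (<⇒≱ <-decided 7≤a)
large-rule r4c₂ 7≤a = ⊥-elim (<⇒≱ <-decided 7≤a)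
large-rule r4d 7≤a = ⊥-elim (<⇒≱ <-decided 7≤a)
large-rule r5 7≤a = ⊥-elim (<⇒≱ <-decided 7≤a)

partners-of-1 : ∀ {b out} → OtherRule 1 b out → b ≡ 1 ⊎ (b ≡ 2 × out ≡ 3 ∷ []) ⊎ b ≡ 3 ⊎ b ≡ 4
partners-of-1 r1a = inj₂ (inj₁ (refl , refl))
partners-of-1 r3a = inj₁ refl
partners-of-1 r4a₁ = inj₂ (inj₂ (inj₂ refl))
partners-of-1 r5 = inj₂ (inj₂ (inj₁ refl))
partners-of-1 (r1b .1 (s≤s ()))
partners-of-1 (r2b .1 (s≤s ()))
partners-of-1 (r3g .1 (s≤s ()))
partners-of-1 (r4e .1 (s≤s ()))

partners-of-2 : ∀ {b out} → OtherRule 2 b out → b ≡ 2 ⊎ b ≡ 3 ⊎ b ≡ 5 ⊎ b ≡ 6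
partners-of-2 (r1b .2 _) = inj₂ (inj₁ refl)
partners-of-2 (r2b .2 _) = inj₂ (inj₂ (inj₂ refl))
partners-of-2 r3b = inj₁ refl
partners-of-2 r4a₂ = inj₂ (inj₂ (inj₁ refl))
partners-of-2 (r3g .2 (s≤s (s≤s ())))
partners-of-2 (r4e .2 (s≤s (s≤s ())))

partners-of-3 : ∀ {b out} → OtherRule 3 b out → b ≡ 3 ⊎ b ≡ 4 ⊎ b ≡ 6 ⊎ b ≡ 7
partners-of-3 (r1b .3 _) = inj₂ (inj₁ refl)
partners-of-3 (r2b .3 _) = inj₂ (inj₂ (inj₂ refl))
partners-of-3 r3c = inj₁ refl
partners-of-3 r4b = inj₂ (inj₂ (inj₁ refl))
partners-of-3 (r3g .3 (s≤s (s≤s (s≤s ()))))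
partners-of-3 (r4e .3 (s≤s (s≤s (s≤s ()))))

partners-of-4 : ∀ {b out} → OtherRule 4 b out → b ≡ 4 ⊎ b ≡ 5 ⊎ (b ≡ 7 × out ≡ 1 ∷ 8 ∷ []) ⊎ b ≡ 8
partners-of-4 (r1b .4 _) = inj₂ (inj₁ refl)
partners-of-4 (r2b .4 _) = inj₂ (inj₂ (inj₂ refl))
partners-of-4 r3d₁ = inj₁ refl
partners-of-4 r3d₂ = inj₁ refl
partners-of-4 r4c₁ = inj₂ (inj₂ (inj₁ (refl , refl)))
partners-of-4 (r3g .4 (s≤s (s≤s (s≤s (s≤s ())))))
partners-of-4 (r4e .4 (s≤s (s≤s (s≤s (s≤s ())))))

-- x < y are adjacent when a rule merges q_x and q_y for large x: y − x ∈ {1, 3, 4}.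
Adjacent : ℕ → ℕ → Set
Adjacent x y = (y ≡ suc x) ⊎ (y ≡ 3 + x) ⊎ (y ≡ 4 + x)

-- The small part (indices 1..6) right after a (2a) move: exactly q₂ and q₄.
low-after-2a : ℕ → ℕ
low-after-2a 2 = 1
low-after-2a 4 = 1
low-after-2a _ = 0

-- The small part (indices 1..7) later on: q₁ and q₂ while their merge by
-- rule (1a) is pending, and q₃ afterwards.
low-carrying : Bool → ℕ → ℕ
low-carrying true 1 = 1
low-carrying true 2 = 1
low-carrying false 3 = 1
low-carrying _ _ = 0

-- Multiplicities right after the (2a) move: no other move was possible
-- before it, so apart from q₂, q₄ every term is simple, has index 7 or
-- ≥ 10, and no two of them are adjacent.
record After2a (f : ℕ → ℕ) : Set where
  field
    simple : ∀ x → 1 ≤ x → f x ≤ 1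
    small : ∀ x → 1 ≤ x → x ≤ 6 → f x ≡ low-after-2a x
    absent-8 : f 8 ≡ 0
    absent-9 : f 9 ≡ 0
    sparse : ∀ x y → 7 ≤ x → x < y → 1 ≤ f x → 1 ≤ f y → ¬ Adjacent x y

GapBelow SparseBelow SparseAbove : (ℕ → ℕ) → ℕ → Set
GapBelow f c = ∀ x → 8 ≤ x → x < c → c < 9 + x → f x ≡ 0
SparseBelow f c = ∀ x y → 8 ≤ x → x < y → y < c → 1 ≤ f x → 1 ≤ f y → ¬ Adjacent x y
SparseAbove f c = ∀ x y → c < x → x < y → 1 ≤ f x → 1 ≤ f y → ¬ Adjacent x y

-- Multiplicities later on: a "carry" c ≥ 8 travels upwards through the large
-- indices.  Everything is simple and the large indices are sparse apart from
-- the carry, so every large move involves c; the constraints just above c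
-- keep this shape after each such move.
record Carrying (f : ℕ → ℕ) (pending : Bool) (c : ℕ) : Set where
  field
    simple : ∀ x → 1 ≤ x → f x ≤ 1
    small : ∀ x → 1 ≤ x → x ≤ 7 → f x ≡ low-carrying pending x
    carry≥8 : 8 ≤ c
    carry-present : 1 ≤ f c
    gap-below : GapBelow f c
    sparse-below : SparseBelow f c
    sparse-above : SparseAbove f c
    -- the output c + 3 of rule (1b) at c is new
    c+1⇒c+3-absent : 1 ≤ f (1 + c) → f (3 + c) ≡ 0
    c+2-absent : f (2 + c) ≡ 0
    -- rule (4e) at c creates c − 5, which must not be adjacent to c − 9
    c-9⇒c+3-absent : ∀ y → 8 ≤ y → 9 + y ≡ c → 1 ≤ f y → f (3 + c) ≡ 0
    -- rules (1b) and (4e) do not apply at c < 13 (so that c − 5 ≥ 8)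
    small-carry : c < 13 → f (1 + c) ≡ 0 × f (3 + c) ≡ 0

zero-or-present : ∀ n → n ≡ 0 ⊎ 1 ≤ n
zero-or-present zero = inj₁ refl
zero-or-present (suc n) = inj₂ (s≤s z≤n)

absent : ∀ {n} → ¬ (1 ≤ n) → n ≡ 0
absent {zero} _ = refl
absent {suc n} not-present = ⊥-elim (not-present (s≤s z≤n))

not-present : ∀ {n} → n ≡ 0 → ¬ (1 ≤ n)
not-present refl ()

shift< : ∀ c i j {ok : True (i <? j)} → i + c < j + c
shift< c i j {ok} = +-monoˡ-< c (toWitness ok)

shift≢ : ∀ c i j {ok : True (i <? j)} → i + c ≢ j + c
shift≢ c i j {ok} = <⇒≢ (shift< c i j {ok})

shift≢′ : ∀ c i j {ok : True (i <? j)} → j + c ≢ i + c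
shift≢′ c i j {ok} = >⇒≢ (shift< c i j {ok})

module MoveEffect (f f' g : ℕ → ℕ) (a b : ℕ) (D : ℕ → ℕ)
  (before : ∀ x → f x ≡ δ a x + (δ b x + g x)) (after : ∀ x → f' x ≡ D x + g x) where

  unchanged : ∀ x → a ≢ x → b ≢ x → D x ≡ 0 → f' x ≡ f x
  unchanged x a≢x b≢x Dx≡0 = trans (after x) (trans (cong (_+ g x) Dx≡0)
    (sym (trans (before x) (cong₂ _+_ (δ-diff a≢x) (cong (_+ g x) (δ-diff b≢x))))))

  rest≤ : ∀ x → g x ≤ f x
  rest≤ x = subst (g x ≤_) (sym (before x)) (≤-trans (m≤n+m (g x) (δ b x)) (m≤n+m _ (δ a x)))

  a-present : 1 ≤ f a
  a-present = subst (1 ≤_) (sym (before a)) (subst (λ m → 1 ≤ m + (δ b a + g a)) (sym (δ-same a)) (s≤s z≤n))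

  b-present : 1 ≤ f b
  b-present = subst (1 ≤_) (sym (before b))
    (≤-trans (subst (1 ≤_) (sym (δ-same b)) ≤-refl) (≤-trans (m≤m+n (δ b b) (g b)) (m≤n+m _ (δ a b))))

  distinct : f a ≤ 1 → a ≢ b
  distinct fa≤1 refl = <⇒≱ (s≤s (s≤s z≤n)) (≤-trans (≤-reflexive twice) fa≤1)
    where
    twice : 2 + g a ≡ f a
    twice = sym (trans (before a) (cong₂ _+_ (δ-same a) (cong (_+ g a) (δ-same a))))

  a-vacated : a ≢ b → D a ≡ 0 → f a ≤ 1 → f' a ≡ 0
  a-vacated a≢b Da≡0 fa≤1 = trans (after a)
    (cong₂ _+_ Da≡0 (absent λ ga≥1 → <⇒≱ (s≤s ga≥1) (≤-trans (≤-reflexive once) fa≤1)))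
    where
    once : 1 + g a ≡ f a
    once = sym (trans (before a) (cong₂ _+_ (δ-same a) (cong (_+ g a) (δ-diff (λ b≡a → a≢b (sym b≡a))))))

  b-vacated : a ≢ b → D b ≡ 0 → f b ≤ 1 → f' b ≡ 0
  b-vacated a≢b Db≡0 fb≤1 = trans (after b)
    (cong₂ _+_ Db≡0 (absent λ gb≥1 → <⇒≱ (s≤s gb≥1) (≤-trans (≤-reflexive once) fb≤1)))
    where
    once : 1 + g b ≡ f b
    once = sym (trans (before b) (cong₂ _+_ (δ-diff a≢b) (cong (_+ g b) (δ-same b))))

  filled : ∀ x → a ≢ x → b ≢ x → D x ≡ 1 → f' x ≡ suc (f x)
  filled x a≢x b≢x Dx≡1 = trans (after x) (trans (cong (_+ g x) Dx≡1)
    (cong suc (sym (trans (before x) (cong₂ _+_ (δ-diff a≢x) (cong (_+ g x) (δ-diff b≢x)))))))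

  simple-after : (∀ x → 1 ≤ x → f x ≤ 1) → (∀ x → D x ≤ 1) → (∀ x → 1 ≤ D x → f x ≡ 0) →
    ∀ x → 1 ≤ x → f' x ≤ 1
  simple-after simple D≤1 new x x≥1 with zero-or-present (D x)
  ... | inj₁ Dx≡0 = subst (_≤ 1) (sym (trans (after x) (cong (_+ g x) Dx≡0))) (≤-trans (rest≤ x) (simple x x≥1))
  ... | inj₂ Dx≥1 = subst (_≤ 1) (sym (trans (after x) (cong (D x +_) gx≡0))) (≤-trans (≤-reflexive (+-identityʳ (D x))) (D≤1 x))
    where
    gx≡0 : g x ≡ 0
    gx≡0 = n≤0⇒n≡0 (subst (g x ≤_) (new x Dx≥1) (rest≤ x))

δ≤1 : ∀ y x → δ y x ≤ 1
δ≤1 y x with y ≟ x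
... | yes _ = s≤s z≤n
... | no _ = z≤n

single≤1 : ∀ o x → mult (o ∷ []) x ≤ 1
single≤1 o x = subst (_≤ 1) (sym (+-identityʳ (δ o x))) (δ≤1 o x)

pair≤1 : ∀ {o p} → o ≢ p → ∀ x → mult (o ∷ p ∷ []) x ≤ 1
pair≤1 {o} {p} o≢p x with x ≟ o | x ≟ p
... | yes refl | yes refl = ⊥-elim (o≢p refl)
... | yes refl | no x≢p = ≤-reflexive (mult₂-first o p o≢p)
... | no x≢o | yes refl = ≤-reflexive (mult₂-second o p o≢p)
... | no x≢o | no x≢p = subst (_≤ 1) (sym (mult₂-other o p x (≢-sym x≢o) (≢-sym x≢p))) z≤n

single-new : ∀ {f : ℕ → ℕ} {o} → f o ≡ 0 → ∀ x → 1 ≤ mult (o ∷ []) x → f x ≡ 0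
single-new {o = o} fo≡0 x present with x ≟ o
... | yes refl = fo≡0
... | no x≢o = ⊥-elim (not-present (mult₁-other o x (≢-sym x≢o)) present)

pair-new : ∀ {f : ℕ → ℕ} {o p} → f o ≡ 0 → f p ≡ 0 → ∀ x → 1 ≤ mult (o ∷ p ∷ []) x → f x ≡ 0
pair-new {o = o} {p} fo≡0 fp≡0 x present with x ≟ o | x ≟ p
... | yes refl | _ = fo≡0
... | no _ | yes refl = fp≡0
... | no x≢o | no x≢p = ⊥-elim (not-present (mult₂-other o p x (≢-sym x≢o) (≢-sym x≢p)) present)

module CarryMovesUp {f f' : ℕ → ℕ} {c c'} (c≤c' : c ≤ c')
  (kept-below : ∀ x → x < c → f' x ≡ f x) (window : ∀ x → c ≤ x → x < c' → f' x ≡ 0) where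

  gap-moved : GapBelow f c → GapBelow f' c'
  gap-moved gap x 8≤x x<c' c'<9+x with x <? c
  ... | yes x<c = trans (kept-below x x<c) (gap x 8≤x x<c (≤-<-trans c≤c' c'<9+x))
  ... | no x≮c = window x (≮⇒≥ x≮c) x<c'

  sparse-below-moved : SparseBelow f c → SparseBelow f' c'
  sparse-below-moved sparse x y 8≤x x<y y<c' x-present y-present with y <? c
  ... | yes y<c = sparse x y 8≤x x<y y<c (subst (1 ≤_) (kept-below x (<-trans x<y y<c)) x-present)
        (subst (1 ≤_) (kept-below y y<c) y-present)
  ... | no y≮c = ⊥-elim (not-present (window y (≮⇒≥ y≮c) y<c') y-present)

sparse-above-moved : ∀ {f f' : ℕ → ℕ} {c c'} → c ≤ c' → (∀ x → c' < x → f' x ≡ f x) →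
  SparseAbove f c → SparseAbove f' c'
sparse-above-moved c≤c' kept-above sparse x y c'<x x<y x-present y-present =
  sparse x y (≤-<-trans c≤c' c'<x) x<y (subst (1 ≤_) (kept-above x c'<x) x-present)
    (subst (1 ≤_) (kept-above y (<-trans c'<x x<y)) y-present)

empty-window : ∀ {f : ℕ → ℕ} c k → (∀ i → i < k → f (i + c) ≡ 0) → ∀ x → c ≤ x → x < k + c → f x ≡ 0
empty-window {f} c k offsets x c≤x x<k+c =
  subst (λ m → f m ≡ 0) x≡ (offsets (x ∸ c) (+-cancelʳ-< c (x ∸ c) k (subst (_< k + c) (sym x≡) x<k+c)))
  where
  x≡ : x ∸ c + c ≡ x
  x≡ = m∸n+n≡m c≤x

-- Rule (4c) at q₄, q₇ → q₁, q₈, the only move after (2a), starts the carry at 8.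
start-4c : ∀ {f f' g} → After2a f → (∀ x → f x ≡ δ 4 x + (δ 7 x + g x)) →
  (∀ x → f' x ≡ mult (1 ∷ 8 ∷ []) x + g x) → Carrying f' true 8
start-4c {f} {f'} {g} I before after = record
  { simple = simple-after simple (pair≤1 {1} {8} (λ ())) (pair-new (small 1 (s≤s z≤n) (s≤s z≤n)) absent-8)
  ; small = small′
  ; carry≥8 = ≤-refl
  ; carry-present = ≤-reflexive (sym new8)
  ; gap-below = λ x 8≤x x<8 _ → ⊥-elim (<⇒≱ x<8 8≤x)
  ; sparse-below = λ x y 8≤x x<y y<8 _ _ _ → ⊥-elim (<⇒≱ (<-trans x<y y<8) 8≤x)
  ; sparse-above = sparse-above′
  ; c+1⇒c+3-absent = λ present → ⊥-elim (not-present (trans (kept 9 (λ ()) (λ ()) (λ ()) (λ ())) absent-9) present)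
  ; c+2-absent = trans (kept 10 (λ ()) (λ ()) (λ ()) (λ ())) old10
  ; c-9⇒c+3-absent = λ { y _ () _ }
  ; small-carry = λ _ → trans (kept 9 (λ ()) (λ ()) (λ ()) (λ ())) absent-9 , trans (kept 11 (λ ()) (λ ()) (λ ()) (λ ())) old11 }
  where
  open After2a I
  open MoveEffect f f' g 4 7 (mult (1 ∷ 8 ∷ [])) before after
  kept : ∀ x → 4 ≢ x → 7 ≢ x → 1 ≢ x → 8 ≢ x → f' x ≡ f x
  kept x 4≢x 7≢x 1≢x 8≢x = unchanged x 4≢x 7≢x (mult₂-other 1 8 x 1≢x 8≢x)
  -- q₇ is present, so q₁₀ and q₁₁ (adjacent to it) are not
  old10 : f 10 ≡ 0
  old10 = absent λ present → sparse 7 10 <-decided <-decided b-present present (inj₂ (inj₁ refl))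
  old11 : f 11 ≡ 0
  old11 = absent λ present → sparse 7 11 <-decided <-decided b-present present (inj₂ (inj₂ refl))
  new8 : f' 8 ≡ 1
  new8 = trans (filled 8 (λ ()) (λ ()) (mult₂-second 1 8 (λ ()))) (cong suc absent-8)
  small′ : ∀ x → 1 ≤ x → x ≤ 7 → f' x ≡ low-carrying true x
  small′ 1 _ _ = trans (filled 1 (λ ()) (λ ()) (mult₂-first 1 8 (λ ()))) (cong suc (small 1 (s≤s z≤n) (s≤s z≤n)))
  small′ 2 x≥1 x≤6 = trans (kept 2 (λ ()) (λ ()) (λ ()) (λ ())) (small 2 x≥1 (s≤s (s≤s z≤n)))
  small′ 3 x≥1 x≤6 = trans (kept 3 (λ ()) (λ ()) (λ ()) (λ ())) (small 3 x≥1 (s≤s (s≤s (s≤s z≤n))))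
  small′ 4 _ _ = a-vacated (λ ()) (mult₂-other 1 8 4 (λ ()) (λ ())) (simple 4 (s≤s z≤n))
  small′ 5 x≥1 x≤6 = trans (kept 5 (λ ()) (λ ()) (λ ()) (λ ())) (small 5 x≥1 <-decided)
  small′ 6 x≥1 x≤6 = trans (kept 6 (λ ()) (λ ()) (λ ()) (λ ())) (small 6 x≥1 <-decided)
  small′ 7 _ _ = b-vacated (λ ()) (mult₂-other 1 8 7 (λ ()) (λ ())) (simple 7 (s≤s z≤n))
  small′ (suc (suc (suc (suc (suc (suc (suc (suc x)))))))) _ x≤7 = ⊥-elim (<⇒≱ <-decided x≤7)
  kept-above : ∀ x → 8 < x → f' x ≡ f x
  kept-above x 8<x = kept x (<⇒≢ (<-trans <-decided 8<x)) (<⇒≢ (<-trans <-decided 8<x))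
    (<⇒≢ (<-trans <-decided 8<x)) (<⇒≢ 8<x)
  sparse-above′ : ∀ x y → 8 < x → x < y → 1 ≤ f' x → 1 ≤ f' y → ¬ Adjacent x y
  sparse-above′ x y 8<x x<y x-present y-present = sparse x y (≤-trans <-decided 8<x) x<y
    (subst (1 ≤_) (kept-above x 8<x) x-present) (subst (1 ≤_) (kept-above y (<-trans 8<x x<y)) y-present)

merge-1a : ∀ {f f' g c} → Carrying f true c → (∀ x → f x ≡ δ 1 x + (δ 2 x + g x)) →
  (∀ x → f' x ≡ mult (3 ∷ []) x + g x) → Carrying f' false c
merge-1a {f} {f'} {g} {c} I before after = record
  { simple = simple-after simple (single≤1 3) (single-new (small 3 (s≤s z≤n) <-decided))
  ; small = small′
  ; carry≥8 = carry≥8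
  ; carry-present = subst (1 ≤_) (sym (kept-large c carry≥8)) carry-present
  ; gap-below = λ x 8≤x x<c c<9+x → trans (kept-large x 8≤x) (gap-below x 8≤x x<c c<9+x)
  ; sparse-below = λ x y 8≤x x<y y<c x-present y-present → sparse-below x y 8≤x x<y y<c
      (subst (1 ≤_) (kept-large x 8≤x) x-present) (subst (1 ≤_) (kept-large y (≤-trans 8≤x (<⇒≤ x<y))) y-present)
  ; sparse-above = sparse-above-moved ≤-refl (λ x c<x → kept-large x (≤-trans carry≥8 (<⇒≤ c<x))) sparse-above
  ; c+1⇒c+3-absent = λ present → trans (kept-large (3 + c) (above 3))
      (c+1⇒c+3-absent (subst (1 ≤_) (kept-large (1 + c) (above 1)) present))
  ; c+2-absent = trans (kept-large (2 + c) (above 2)) c+2-absent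
  ; c-9⇒c+3-absent = λ y 8≤y 9+y≡c present → trans (kept-large (3 + c) (above 3))
      (c-9⇒c+3-absent y 8≤y 9+y≡c (subst (1 ≤_) (kept-large y 8≤y) present))
  ; small-carry = λ c<13 → trans (kept-large (1 + c) (above 1)) (proj₁ (small-carry c<13)) ,
      trans (kept-large (3 + c) (above 3)) (proj₂ (small-carry c<13)) }
  where
  open Carrying I
  open MoveEffect f f' g 1 2 (mult (3 ∷ [])) before after
  above : ∀ k → 8 ≤ k + c
  above k = ≤-trans carry≥8 (m≤n+m c k)
  kept : ∀ x → 1 ≢ x → 2 ≢ x → 3 ≢ x → f' x ≡ f x
  kept x 1≢x 2≢x 3≢x = unchanged x 1≢x 2≢x (mult₁-other 3 x 3≢x)
  kept-large : ∀ x → 8 ≤ x → f' x ≡ f x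
  kept-large x 8≤x = kept x (<⇒≢ (≤-trans <-decided 8≤x)) (<⇒≢ (≤-trans <-decided 8≤x)) (<⇒≢ (≤-trans <-decided 8≤x))
  small′ : ∀ x → 1 ≤ x → x ≤ 7 → f' x ≡ low-carrying false x
  small′ 1 _ _ = a-vacated (λ ()) (mult₁-other 3 1 (λ ())) (simple 1 (s≤s z≤n))
  small′ 2 _ _ = b-vacated (λ ()) (mult₁-other 3 2 (λ ())) (simple 2 (s≤s z≤n))
  small′ 3 x≥1 x≤7 = trans (filled 3 (λ ()) (λ ()) (mult₁-self 3)) (cong suc (small 3 x≥1 x≤7))
  small′ 4 x≥1 x≤7 = trans (kept 4 (λ ()) (λ ()) (λ ())) (small 4 x≥1 x≤7)
  small′ 5 x≥1 x≤7 = trans (kept 5 (λ ()) (λ ()) (λ ())) (small 5 x≥1 x≤7)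
  small′ 6 x≥1 x≤7 = trans (kept 6 (λ ()) (λ ()) (λ ())) (small 6 x≥1 x≤7)
  small′ 7 x≥1 x≤7 = trans (kept 7 (λ ()) (λ ()) (λ ())) (small 7 x≥1 x≤7)
  small′ (suc (suc (suc (suc (suc (suc (suc (suc x)))))))) _ x≤7 = ⊥-elim (<⇒≱ <-decided x≤7)

carry-1b : ∀ {f f' g p c} → Carrying f p c → (∀ x → f x ≡ δ c x + (δ (1 + c) x + g x)) →
  (∀ x → f' x ≡ mult (3 + c ∷ []) x + g x) → Carrying f' p (3 + c)
carry-1b {f} {f'} {g} {p} {c} I before after = record
  { simple = simple-after simple (single≤1 (3 + c)) (single-new {f} old3)
  ; small = λ x x≥1 x≤7 → trans (kept-below x (≤-trans (s≤s x≤7) carry≥8)) (small x x≥1 x≤7)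
  ; carry≥8 = ≤-trans carry≥8 (m≤n+m c 3)
  ; carry-present = ≤-reflexive (sym new3)
  ; gap-below = gap-moved gap-below
  ; sparse-below = sparse-below-moved sparse-below
  ; sparse-above = sparse-above-moved (m≤n+m c 3) kept-above sparse-above
  ; c+1⇒c+3-absent = λ present → ⊥-elim (not-present old4 (subst (1 ≤_) (kept-above (4 + c) (shift< c 3 4)) present))
  ; c+2-absent = trans (kept-above (5 + c) (shift< c 3 5)) old5
  ; c-9⇒c+3-absent = c-9⇒c+3-absent′
  ; small-carry = λ c+3<13 → ⊥-elim (not-present (proj₁ (small-carry (<-trans (shift< c 0 3) c+3<13))) b-present) }
  where
  open Carrying I
  open MoveEffect f f' g c (1 + c) (mult (3 + c ∷ [])) before after
  kept : ∀ x → c ≢ x → 1 + c ≢ x → 3 + c ≢ x → f' x ≡ f x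
  kept x c≢x c+1≢x c+3≢x = unchanged x c≢x c+1≢x (mult₁-other (3 + c) x c+3≢x)
  kept-below : ∀ x → x < c → f' x ≡ f x
  kept-below x x<c = kept x (>⇒≢ x<c) (>⇒≢ (<-trans x<c (shift< c 0 1))) (>⇒≢ (<-trans x<c (shift< c 0 3)))
  kept-above : ∀ x → 3 + c < x → f' x ≡ f x
  kept-above x c+3<x = kept x (<⇒≢ (<-trans (shift< c 0 3) c+3<x)) (<⇒≢ (<-trans (shift< c 1 3) c+3<x)) (<⇒≢ c+3<x)
  old3 : f (3 + c) ≡ 0
  old3 = c+1⇒c+3-absent b-present
  -- q_{c+1} is present, so the adjacent q_{c+4} and q_{c+5} are not
  old4 : f (4 + c) ≡ 0
  old4 = absent λ present → sparse-above (1 + c) (4 + c) (shift< c 0 1) (shift< c 1 4) b-present present (inj₂ (inj₁ refl))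
  old5 : f (5 + c) ≡ 0
  old5 = absent λ present → sparse-above (1 + c) (5 + c) (shift< c 0 1) (shift< c 1 5) b-present present (inj₂ (inj₂ refl))
  new3 : f' (3 + c) ≡ 1
  new3 = trans (filled (3 + c) (shift≢ c 0 3) (shift≢ c 1 3) (mult₁-self (3 + c))) (cong suc old3)
  window : ∀ i → i < 3 → f' (i + c) ≡ 0
  window 0 _ = a-vacated (shift≢ c 0 1) (mult₁-other (3 + c) c (shift≢′ c 0 3)) (simple c (≤-trans (s≤s z≤n) carry≥8))
  window 1 _ = b-vacated (shift≢ c 0 1) (mult₁-other (3 + c) (1 + c) (shift≢′ c 1 3)) (simple (1 + c) (s≤s z≤n))
  window 2 _ = trans (kept (2 + c) (shift≢ c 0 2) (shift≢ c 1 2) (shift≢′ c 2 3)) c+2-absent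
  window (suc (suc (suc i))) i<3 = ⊥-elim (<⇒≱ i<3 (m≤m+n 3 i))
  open CarryMovesUp (m≤n+m c 3) kept-below (empty-window c 3 window)
  -- q_{c−6} would lie in the old gap below c
  c-9⇒c+3-absent′ : ∀ y → 8 ≤ y → 9 + y ≡ 3 + c → 1 ≤ f' y → f' (3 + (3 + c)) ≡ 0
  c-9⇒c+3-absent′ y 8≤y 9+y≡c+3 present = ⊥-elim (not-present (trans (kept-below y y<c) (gap-below y 8≤y y<c c<9+y)) present)
    where
    6+y≡c : 6 + y ≡ c
    6+y≡c = +-cancelˡ-≡ 3 (6 + y) c 9+y≡c+3
    y<c : y < c
    y<c = subst (y <_) 6+y≡c (m<n+m y (s≤s z≤n))
    c<9+y : c < 9 + y
    c<9+y = subst (_< 9 + y) 6+y≡c (shift< y 6 9)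

carry-2b : ∀ {f f' g p c} → Carrying f p c → (∀ x → f x ≡ δ c x + (δ (4 + c) x + g x)) →
  (∀ x → f' x ≡ mult (5 + c ∷ []) x + g x) → Carrying f' p (5 + c)
carry-2b {f} {f'} {g} {p} {c} I before after = record
  { simple = simple-after simple (single≤1 (5 + c)) (single-new {f} old5)
  ; small = λ x x≥1 x≤7 → trans (kept-below x (≤-trans (s≤s x≤7) carry≥8)) (small x x≥1 x≤7)
  ; carry≥8 = ≤-trans carry≥8 (m≤n+m c 5)
  ; carry-present = ≤-reflexive (sym new5)
  ; gap-below = gap-moved gap-below
  ; sparse-below = sparse-below-moved sparse-below
  ; sparse-above = sparse-above-moved (m≤n+m c 5) kept-above sparse-above
  ; c+1⇒c+3-absent = λ _ → trans (kept-above (8 + c) (shift< c 5 8)) old8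
  ; c+2-absent = trans (kept-above (7 + c) (shift< c 5 7)) old7
  ; c-9⇒c+3-absent = c-9⇒c+3-absent′
  ; small-carry = λ c+5<13 → ⊥-elim (<⇒≱ c+5<13 (+-monoʳ-≤ 5 carry≥8)) }
  where
  open Carrying I
  open MoveEffect f f' g c (4 + c) (mult (5 + c ∷ [])) before after
  kept : ∀ x → c ≢ x → 4 + c ≢ x → 5 + c ≢ x → f' x ≡ f x
  kept x c≢x c+4≢x c+5≢x = unchanged x c≢x c+4≢x (mult₁-other (5 + c) x c+5≢x)
  kept-below : ∀ x → x < c → f' x ≡ f x
  kept-below x x<c = kept x (>⇒≢ x<c) (>⇒≢ (<-trans x<c (shift< c 0 4))) (>⇒≢ (<-trans x<c (shift< c 0 5)))
  kept-above : ∀ x → 5 + c < x → f' x ≡ f x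
  kept-above x c+5<x = kept x (<⇒≢ (<-trans (shift< c 0 5) c+5<x)) (<⇒≢ (<-trans (shift< c 4 5) c+5<x)) (<⇒≢ c+5<x)
  -- q_{c+4} is present, so the adjacent q_{c+1}, q_{c+3}, q_{c+5}, q_{c+7}, q_{c+8} are not
  old1 : f (1 + c) ≡ 0
  old1 = absent λ present → sparse-above (1 + c) (4 + c) (shift< c 0 1) (shift< c 1 4) present b-present (inj₂ (inj₁ refl))
  old3 : f (3 + c) ≡ 0
  old3 = absent λ present → sparse-above (3 + c) (4 + c) (shift< c 0 3) (shift< c 3 4) present b-present (inj₁ refl)
  old5 : f (5 + c) ≡ 0
  old5 = absent λ present → sparse-above (4 + c) (5 + c) (shift< c 0 4) (shift< c 4 5) b-present present (inj₁ refl)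
  old7 : f (7 + c) ≡ 0
  old7 = absent λ present → sparse-above (4 + c) (7 + c) (shift< c 0 4) (shift< c 4 7) b-present present (inj₂ (inj₁ refl))
  old8 : f (8 + c) ≡ 0
  old8 = absent λ present → sparse-above (4 + c) (8 + c) (shift< c 0 4) (shift< c 4 8) b-present present (inj₂ (inj₂ refl))
  new5 : f' (5 + c) ≡ 1
  new5 = trans (filled (5 + c) (shift≢ c 0 5) (shift≢ c 4 5) (mult₁-self (5 + c))) (cong suc old5)
  window : ∀ i → i < 5 → f' (i + c) ≡ 0
  window 0 _ = a-vacated (shift≢ c 0 4) (mult₁-other (5 + c) c (shift≢′ c 0 5)) (simple c (≤-trans (s≤s z≤n) carry≥8))
  window 1 _ = trans (kept (1 + c) (shift≢ c 0 1) (shift≢′ c 1 4) (shift≢′ c 1 5)) old1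
  window 2 _ = trans (kept (2 + c) (shift≢ c 0 2) (shift≢′ c 2 4) (shift≢′ c 2 5)) c+2-absent
  window 3 _ = trans (kept (3 + c) (shift≢ c 0 3) (shift≢′ c 3 4) (shift≢′ c 3 5)) old3
  window 4 _ = b-vacated (shift≢ c 0 4) (mult₁-other (5 + c) (4 + c) (shift≢′ c 4 5)) (simple (4 + c) (s≤s z≤n))
  window (suc (suc (suc (suc (suc i))))) i<5 = ⊥-elim (<⇒≱ i<5 (m≤m+n 5 i))
  open CarryMovesUp (m≤n+m c 5) kept-below (empty-window c 5 window)
  -- q_{c−4} would lie in the old gap below c
  c-9⇒c+3-absent′ : ∀ y → 8 ≤ y → 9 + y ≡ 5 + c → 1 ≤ f' y → f' (3 + (5 + c)) ≡ 0
  c-9⇒c+3-absent′ y 8≤y 9+y≡c+5 present = ⊥-elim (not-present (trans (kept-below y y<c) (gap-below y 8≤y y<c c<9+y)) present)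
    where
    4+y≡c : 4 + y ≡ c
    4+y≡c = +-cancelˡ-≡ 5 (4 + y) c 9+y≡c+5
    y<c : y < c
    y<c = subst (y <_) 4+y≡c (m<n+m y (s≤s z≤n))
    c<9+y : c < 9 + y
    c<9+y = subst (_< 9 + y) 4+y≡c (shift< y 4 9)

-- Rule (4e) at the carry c = 5 + d: q_c, q_{c+3} → q_d, q_{c+4}; the carry
-- moves to c + 4 = 9 + d, leaving the new term q_d behind, below its gap.
carry-4e : ∀ {f f' g p d} → Carrying f p (5 + d) → (∀ x → f x ≡ δ (5 + d) x + (δ (8 + d) x + g x)) →
  (∀ x → f' x ≡ mult (d ∷ 9 + d ∷ []) x + g x) → Carrying f' p (9 + d)
carry-4e {f} {f'} {g} {p} {d} I before after = record
  { simple = simple-after simple (pair≤1 {d} {9 + d} (<⇒≢ (d< 8))) (pair-new {f} {d} {9 + d} old-d old9)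
  ; small = λ x x≥1 x≤7 → trans (kept-below x (≤-trans (s≤s x≤7) d≥8)) (small x x≥1 x≤7)
  ; carry≥8 = ≤-trans d≥8 (m≤n+m d 9)
  ; carry-present = ≤-reflexive (sym new9)
  ; gap-below = λ x 8≤x x<9+d 9+d<9+x → window x (+-cancelˡ-< 9 d x 9+d<9+x) x<9+d
  ; sparse-below = sparse-below′
  ; sparse-above = sparse-above-moved (+-monoˡ-≤ d (≤-decided {5} {9})) kept-above sparse-above
  ; c+1⇒c+3-absent = λ _ → trans (kept-above (12 + d) (shift< d 9 12)) old12
  ; c+2-absent = trans (kept-above (11 + d) (shift< d 9 11)) old11
  ; c-9⇒c+3-absent = λ _ _ _ _ → trans (kept-above (12 + d) (shift< d 9 12)) old12
  ; small-carry = λ 9+d<13 → ⊥-elim (<⇒≱ 9+d<13 (+-monoʳ-≤ 9 (≤-trans (≤-decided {4} {8}) d≥8))) }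
  where
  open Carrying I
  open MoveEffect f f' g (5 + d) (8 + d) (mult (d ∷ 9 + d ∷ [])) before after
  d< : ∀ i → d < suc i + d
  d< i = m<n+m d (s≤s z≤n)
  -- the move needs 5 + d ≥ 13, so that d is a large index
  d≥8 : 8 ≤ d
  d≥8 with 5 + d <? 13
  ... | yes c<13 = ⊥-elim (not-present (proj₂ (small-carry c<13)) b-present)
  ... | no c≮13 = +-cancelˡ-≤ 5 8 d (≮⇒≥ c≮13)
  kept : ∀ x → 5 + d ≢ x → 8 + d ≢ x → d ≢ x → 9 + d ≢ x → f' x ≡ f x
  kept x c≢x c+3≢x d≢x c+4≢x = unchanged x c≢x c+3≢x (mult₂-other d (9 + d) x d≢x c+4≢x)
  kept-below : ∀ x → x < d → f' x ≡ f x
  kept-below x x<d = kept x (>⇒≢ (<-trans x<d (d< 4))) (>⇒≢ (<-trans x<d (d< 7))) (>⇒≢ x<d) (>⇒≢ (<-trans x<d (d< 8)))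
  kept-above : ∀ x → 9 + d < x → f' x ≡ f x
  kept-above x c+4<x = kept x (<⇒≢ (<-trans (shift< d 5 9) c+4<x)) (<⇒≢ (<-trans (shift< d 8 9) c+4<x))
    (<⇒≢ (<-trans (d< 8) c+4<x)) (<⇒≢ c+4<x)
  -- q_d lies in the gap below the old carry 5 + d
  old-d : f d ≡ 0
  old-d = gap-below d d≥8 (d< 4) (shift< d 5 9)
  old9 : f (9 + d) ≡ 0
  old9 = absent λ present → sparse-above (8 + d) (9 + d) (shift< d 5 8) (shift< d 8 9) b-present present (inj₁ refl)
  old11 : f (11 + d) ≡ 0
  old11 = absent λ present → sparse-above (8 + d) (11 + d) (shift< d 5 8) (shift< d 8 11) b-present present (inj₂ (inj₁ refl))
  old12 : f (12 + d) ≡ 0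
  old12 = absent λ present → sparse-above (8 + d) (12 + d) (shift< d 5 8) (shift< d 8 12) b-present present (inj₂ (inj₂ refl))
  new9 : f' (9 + d) ≡ 1
  new9 = trans (filled (9 + d) (shift≢ d 5 9) (shift≢ d 8 9) (mult₂-second d (9 + d) (<⇒≢ (d< 8)))) (cong suc old9)
  in-old-gap : ∀ x → d < x → x < 5 + d → f' x ≡ 0
  in-old-gap x d<x x<c = trans (kept x (>⇒≢ x<c) (>⇒≢ (<-trans x<c (shift< d 5 8))) (<⇒≢ d<x) (>⇒≢ (<-trans x<c (shift< d 5 9))))
    (gap-below x (≤-trans d≥8 (<⇒≤ d<x)) x<c (+-monoʳ-< 5 (<-trans d<x (m<n+m x (s≤s z≤n)))))
  offsets : ∀ i → i < 8 → f' (i + suc d) ≡ 0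
  offsets 0 _ = in-old-gap (1 + d) (d< 0) (shift< d 1 5)
  offsets 1 _ = in-old-gap (2 + d) (d< 1) (shift< d 2 5)
  offsets 2 _ = in-old-gap (3 + d) (d< 2) (shift< d 3 5)
  offsets 3 _ = in-old-gap (4 + d) (d< 3) (shift< d 4 5)
  offsets 4 _ = a-vacated (shift≢ d 5 8) (mult₂-other d (9 + d) (5 + d) (<⇒≢ (d< 4)) (shift≢′ d 5 9)) (simple (5 + d) (s≤s z≤n))
  offsets 5 _ = trans (kept (6 + d) (shift≢ d 5 6) (shift≢′ d 6 8) (<⇒≢ (d< 5)) (shift≢′ d 6 9))
    (absent λ present → not-present (c+1⇒c+3-absent present) b-present)
  offsets 6 _ = trans (kept (7 + d) (shift≢ d 5 7) (shift≢′ d 7 8) (<⇒≢ (d< 6)) (shift≢′ d 7 9)) c+2-absent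
  offsets 7 _ = b-vacated (shift≢ d 5 8) (mult₂-other d (9 + d) (8 + d) (<⇒≢ (d< 7)) (shift≢′ d 8 9)) (simple (8 + d) (s≤s z≤n))
  offsets (suc (suc (suc (suc (suc (suc (suc (suc i)))))))) i<8 = ⊥-elim (<⇒≱ i<8 (m≤m+n 8 i))
  window : ∀ x → d < x → x < 9 + d → f' x ≡ 0
  window = empty-window (suc d) 8 offsets
  -- the new q_d is not adjacent to earlier terms: they lie below the old gap,
  -- or at d − 4 = (5 + d) − 9, which excluded q_{c+3}
  sparse-below′ : SparseBelow f' (9 + d)
  sparse-below′ x y 8≤x x<y y<9+d x-present y-present with <-cmp y d
  ... | tri> _ _ d<y = ⊥-elim (not-present (window y d<y y<9+d) y-present)
  ... | tri< y<d _ _ = sparse-below x y 8≤x x<y (<-trans y<d (d< 4))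
        (subst (1 ≤_) (kept-below x (<-trans x<y y<d)) x-present) (subst (1 ≤_) (kept-below y y<d) y-present)
  ... | tri≈ _ refl _ = not-adjacent
    where
    x-old : 1 ≤ f x
    x-old = subst (1 ≤_) (kept-below x x<y) x-present
    x<c : x < 5 + y
    x<c = <-trans x<y (m<n+m y (s≤s z≤n))
    not-adjacent : ¬ Adjacent x y
    not-adjacent (inj₁ refl) = not-present (gap-below x 8≤x x<c (shift< x 6 9)) x-old
    not-adjacent (inj₂ (inj₁ refl)) = not-present (gap-below x 8≤x x<c (shift< x 8 9)) x-old
    not-adjacent (inj₂ (inj₂ refl)) = not-present (c-9⇒c+3-absent x 8≤x refl x-old) b-present

retarget-input : ∀ {f g : ℕ → ℕ} {a b b'} → b ≡ b' →
  (∀ x → f x ≡ δ a x + (δ b x + g x)) → ∀ x → f x ≡ δ a x + (δ b' x + g x)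
retarget-input refl before = before

retarget-output : ∀ {f' g : ℕ → ℕ} {out out'} → out ≡ out' →
  (∀ x → f' x ≡ mult out x + g x) → ∀ x → f' x ≡ mult out' x + g x
retarget-output refl after = after

present-after-2a : ∀ a → 1 ≤ a → a ≤ 6 → 1 ≤ low-after-2a a → a ≡ 2 ⊎ a ≡ 4
present-after-2a 2 _ _ _ = inj₁ refl
present-after-2a 4 _ _ _ = inj₂ refl
present-after-2a 1 _ _ ()
present-after-2a 3 _ _ ()
present-after-2a 5 _ _ ()
present-after-2a 6 _ _ ()
present-after-2a (suc (suc (suc (suc (suc (suc (suc a))))))) _ a≤6 _ = ⊥-elim (<⇒≱ <-decided a≤6)

present-carrying : ∀ p a → 1 ≤ a → a ≤ 7 → 1 ≤ low-carrying p a →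
  (p ≡ true × (a ≡ 1 ⊎ a ≡ 2)) ⊎ (p ≡ false × a ≡ 3)
present-carrying true 1 _ _ _ = inj₁ (refl , inj₁ refl)
present-carrying true 2 _ _ _ = inj₁ (refl , inj₂ refl)
present-carrying false 3 _ _ _ = inj₂ (refl , refl)
present-carrying true 3 _ _ ()
present-carrying true 4 _ _ ()
present-carrying true 5 _ _ ()
present-carrying true 6 _ _ ()
present-carrying true 7 _ _ ()
present-carrying false 1 _ _ ()
present-carrying false 2 _ _ ()
present-carrying false 4 _ _ ()
present-carrying false 5 _ _ ()
present-carrying false 6 _ _ ()
present-carrying false 7 _ _ ()
present-carrying p (suc (suc (suc (suc (suc (suc (suc (suc a)))))))) _ a≤7 _ = ⊥-elim (<⇒≱ <-decided a≤7)

Adjacent-< : ∀ {x y} → Adjacent x y → x < y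
Adjacent-< (inj₁ refl) = ≤-refl
Adjacent-< (inj₂ (inj₁ refl)) = m<n+m _ (s≤s z≤n)
Adjacent-< (inj₂ (inj₂ refl)) = m<n+m _ (s≤s z≤n)

Adjacent-≤ : ∀ {x y} → Adjacent x y → y ≤ 4 + x
Adjacent-≤ (inj₁ refl) = +-monoˡ-≤ _ (s≤s z≤n)
Adjacent-≤ (inj₂ (inj₁ refl)) = +-monoˡ-≤ _ (s≤s (s≤s (s≤s (z≤n {1}))))
Adjacent-≤ (inj₂ (inj₂ refl)) = ≤-refl

-- After (2a), the only possible move is (4c) at q₄, q₇, which starts the carry.
after-2a-step : ∀ {f f' g a b out} → After2a f → OtherRule a b out →
  (∀ x → f x ≡ δ a x + (δ b x + g x)) → (∀ x → f' x ≡ mult out x + g x) → Carrying f' true 8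
after-2a-step {f} {f'} {g} {a} {b} {out} I rule before after =
  by-inputs a b out rule before after a-present b-present (distinct (simple a (rule-left≥1 rule)))
  where
  open After2a I
  open MoveEffect f f' g a b (mult out) before after
  by-inputs : ∀ a b out → OtherRule a b out → (∀ x → f x ≡ δ a x + (δ b x + g x)) →
    (∀ x → f' x ≡ mult out x + g x) → 1 ≤ f a → 1 ≤ f b → a ≢ b → Carrying f' true 8
  by-inputs a b out rule before after a-present b-present a≢b with a ≤? 6
  ... | yes a≤6 with present-after-2a a (rule-left≥1 rule) a≤6 (subst (1 ≤_) (small a (rule-left≥1 rule) a≤6) a-present)
  ...   | inj₁ refl with partners-of-2 rule
  ...     | inj₁ refl = ⊥-elim (a≢b refl)
  ...     | inj₂ (inj₁ refl) = ⊥-elim (not-present (small 3 (s≤s z≤n) <-decided) b-present)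
  ...     | inj₂ (inj₂ (inj₁ refl)) = ⊥-elim (not-present (small 5 (s≤s z≤n) <-decided) b-present)
  ...     | inj₂ (inj₂ (inj₂ refl)) = ⊥-elim (not-present (small 6 (s≤s z≤n) <-decided) b-present)
  by-inputs a b out rule before after a-present b-present a≢b | yes a≤6 | inj₂ refl with partners-of-4 rule
  ...     | inj₁ refl = ⊥-elim (a≢b refl)
  ...     | inj₂ (inj₁ refl) = ⊥-elim (not-present (small 5 (s≤s z≤n) <-decided) b-present)
  ...     | inj₂ (inj₂ (inj₁ (refl , refl))) = start-4c I before after
  ...     | inj₂ (inj₂ (inj₂ refl)) = ⊥-elim (not-present absent-8 b-present)
  by-inputs a b out rule before after a-present b-present a≢b | no a≰6 with large-rule rule (≰⇒> a≰6)
  ... | inj₁ refl = ⊥-elim (a≢b refl)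
  ... | inj₂ (inj₁ (refl , _)) = ⊥-elim (sparse a b (≰⇒> a≰6) ≤-refl a-present b-present (inj₁ refl))
  ... | inj₂ (inj₂ (inj₁ (refl , _))) =
        ⊥-elim (sparse a b (≰⇒> a≰6) (Adjacent-< adjacent) a-present b-present adjacent)
    where
    adjacent : Adjacent a (a + 3)
    adjacent = inj₂ (inj₁ (+-comm a 3))
  ... | inj₂ (inj₂ (inj₂ (refl , _))) =
        ⊥-elim (sparse a b (≰⇒> a≰6) (Adjacent-< adjacent) a-present b-present adjacent)
    where
    adjacent : Adjacent a (a + 4)
    adjacent = inj₂ (inj₂ (+-comm a 4))

Carries : (ℕ → ℕ) → Set
Carries f = Σ Bool λ p → Σ ℕ λ c → Carrying f p c

-- A move with a large left input involves the carry: a large index adjacent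
-- to a present one lies neither above, nor far below, nor just below c.
carry-is-left : ∀ {f p c a b} → Carrying f p c → 8 ≤ a → Adjacent a b → 1 ≤ f a → 1 ≤ f b → a ≡ c
carry-is-left {c = c} {a} {b} I 8≤a adjacent a-present b-present with <-cmp a c
... | tri> _ _ c<a = ⊥-elim (sparse-above a b c<a (Adjacent-< adjacent) a-present b-present adjacent)
  where open Carrying I
... | tri≈ _ a≡c _ = a≡c
... | tri< a<c _ _ with c <? 9 + a
...   | yes c<9+a = ⊥-elim (not-present (gap-below a 8≤a a<c c<9+a) a-present)
  where open Carrying I
...   | no c≮9+a = ⊥-elim (sparse-below a b 8≤a (Adjacent-< adjacent) b<c a-present b-present adjacent)
  where
  open Carrying I
  b<c : b < c
  b<c = ≤-<-trans (Adjacent-≤ adjacent) (<-≤-trans (shift< a 4 9) (≮⇒≥ c≮9+a))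

carrying-large-step : ∀ {f f' g a b out p c} → Carrying f p c → 8 ≤ a → LargeRule a b out →
  (∀ x → f x ≡ δ a x + (δ b x + g x)) → (∀ x → f' x ≡ mult out x + g x) →
  1 ≤ f a → 1 ≤ f b → a ≢ b → Carries f'
carrying-large-step I 8≤a (inj₁ refl) _ _ _ _ a≢b = ⊥-elim (a≢b refl)
carrying-large-step {a = a} {p = p} I 8≤a (inj₂ (inj₁ (refl , refl))) before after a-present b-present _
  with carry-is-left I 8≤a (inj₁ refl) a-present b-present
... | refl = p , 3 + a , carry-1b I before (retarget-output (cong (_∷ []) (+-comm a 3)) after)
carrying-large-step {g = g} {a = a} {p = p} I 8≤a (inj₂ (inj₂ (inj₁ (refl , refl)))) before after a-present b-present _
  with carry-is-left I 8≤a (inj₂ (inj₁ (+-comm a 3))) a-present b-present | m≤n⇒∃[o]m+o≡n (≤-trans (≤-decided {5} {8}) 8≤a)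
... | refl | d , refl = p , 9 + d , carry-4e I (retarget-input {g = g} {a = 5 + d} (+-comm (5 + d) 3) before)
      (retarget-output (cong (λ m → d ∷ m ∷ []) (+-comm (5 + d) 4)) after)
carrying-large-step {g = g} {a = a} {p = p} I 8≤a (inj₂ (inj₂ (inj₂ (refl , refl)))) before after a-present b-present _
  with carry-is-left I 8≤a (inj₂ (inj₂ (+-comm a 4))) a-present b-present
... | refl = p , 5 + a , carry-2b I (retarget-input {g = g} {a = a} (+-comm a 4) before) (retarget-output (cong (_∷ []) (+-comm a 5)) after)

carrying-step : ∀ {f f' g a b out p c} → Carrying f p c → OtherRule a b out →
  (∀ x → f x ≡ δ a x + (δ b x + g x)) → (∀ x → f' x ≡ mult out x + g x) → Carries f'
carrying-step {f} {f'} {g} {a} {b} {out} {p} {c} I rule before after =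
  by-inputs p c I a b out rule before after a-present b-present (distinct (Carrying.simple I a (rule-left≥1 rule)))
  where
  open MoveEffect f f' g a b (mult out) before after
  by-inputs : ∀ p c → Carrying f p c → ∀ a b out → OtherRule a b out → (∀ x → f x ≡ δ a x + (δ b x + g x)) →
    (∀ x → f' x ≡ mult out x + g x) → 1 ≤ f a → 1 ≤ f b → a ≢ b → Carries f'
  by-inputs p c I a b out rule before after a-present b-present a≢b with a ≤? 7
  ... | no a≰7 = carrying-large-step I (≰⇒> a≰7) (large-rule rule (<⇒≤ (≰⇒> a≰7))) before after a-present b-present a≢b
  ... | yes a≤7 with present-carrying p a (rule-left≥1 rule) a≤7 (subst (1 ≤_) (Carrying.small I a (rule-left≥1 rule) a≤7) a-present)
  ...   | inj₁ (refl , inj₁ refl) with partners-of-1 rule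
  ...     | inj₁ refl = ⊥-elim (a≢b refl)
  ...     | inj₂ (inj₁ (refl , refl)) = false , c , merge-1a I before after
  ...     | inj₂ (inj₂ (inj₁ refl)) = ⊥-elim (not-present (Carrying.small I 3 (s≤s z≤n) <-decided) b-present)
  ...     | inj₂ (inj₂ (inj₂ refl)) = ⊥-elim (not-present (Carrying.small I 4 (s≤s z≤n) <-decided) b-present)
  by-inputs p c I a b out rule before after a-present b-present a≢b | yes a≤7 | inj₁ (refl , inj₂ refl) with partners-of-2 rule
  ...     | inj₁ refl = ⊥-elim (a≢b refl)
  ...     | inj₂ (inj₁ refl) = ⊥-elim (not-present (Carrying.small I 3 (s≤s z≤n) <-decided) b-present)
  ...     | inj₂ (inj₂ (inj₁ refl)) = ⊥-elim (not-present (Carrying.small I 5 (s≤s z≤n) <-decided) b-present)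
  ...     | inj₂ (inj₂ (inj₂ refl)) = ⊥-elim (not-present (Carrying.small I 6 (s≤s z≤n) <-decided) b-present)
  by-inputs p c I a b out rule before after a-present b-present a≢b | yes a≤7 | inj₂ (refl , refl) with partners-of-3 rule
  ...     | inj₁ refl = ⊥-elim (a≢b refl)
  ...     | inj₂ (inj₁ refl) = ⊥-elim (not-present (Carrying.small I 4 (s≤s z≤n) <-decided) b-present)
  ...     | inj₂ (inj₂ (inj₁ refl)) = ⊥-elim (not-present (Carrying.small I 6 (s≤s z≤n) <-decided) b-present)
  ...     | inj₂ (inj₂ (inj₂ refl)) = ⊥-elim (not-present (Carrying.small I 7 (s≤s z≤n) ≤-refl) b-present)

-- The shapes a position can have after the first (2a) move; both lack q₅.
Shape : (ℕ → ℕ) → Set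
Shape f = After2a f ⊎ Carries f

shape-step : ∀ {P P'} → Shape (mult P) → OtherMove P P' → Shape (mult P')
shape-step (inj₁ I) (a , b , out , rest , rule , P↭ , P'↭) =
  inj₂ (true , 8 , after-2a-step I rule (mult-↭ P↭) (λ x → trans (mult-↭ P'↭ x) (mult-++ out rest x)))
shape-step (inj₂ (p , c , I)) (a , b , out , rest , rule , P↭ , P'↭) =
  inj₂ (carrying-step I rule (mult-↭ P↭) (λ x → trans (mult-↭ P'↭ x) (mult-++ out rest x)))

no-q5 : ∀ {f} → Shape f → ¬ (1 ≤ f 5)
no-q5 (inj₁ I) = not-present (After2a.small I 5 (s≤s z≤n) <-decided)
no-q5 (inj₂ (true , c , I)) = not-present (Carrying.small I 5 (s≤s z≤n) <-decided)
no-q5 (inj₂ (false , c , I)) = not-present (Carrying.small I 5 (s≤s z≤n) <-decided)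

rotate : ∀ (a b c d : ℕ) zs → a ∷ b ∷ c ∷ d ∷ zs ↭ c ∷ d ∷ a ∷ b ∷ zs
rotate a b c d zs = ↭-trans (Perm.prep a (Perm.swap b c ↭-refl))
  (↭-trans (Perm.swap a c ↭-refl) (↭-trans (Perm.prep c (Perm.prep a (Perm.swap b d ↭-refl))) (Perm.prep c (Perm.swap a d ↭-refl))))

-- Right after (2a): since no other move was possible in P = q₁, q₅, rest,
-- the rest contains none of 1, …, 6, 8, 9, is simple and sparse.
after-2a-shape : ∀ {P P' rest} → ¬ (Σ Position λ P'' → OtherMove P P'') →
  P ↭ 1 ∷ 5 ∷ rest → P' ↭ 2 ∷ 4 ∷ rest → After2a (mult P')
after-2a-shape {P} {P'} {rest} stuck P↭ P'↭ = record
  { simple = simple′ ; small = small′ ; absent-8 = trans (after 8) rest8 ; absent-9 = trans (after 9) rest9 ; sparse = sparse′ }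
  where
  r = mult rest
  after : ∀ x → mult P' x ≡ δ 2 x + (δ 4 x + r x)
  after = mult-↭ P'↭
  impossible : ∀ {a b out} rest′ → P ↭ a ∷ b ∷ rest′ → OtherRule a b out → ⊥
  impossible {a} {b} {out} rest′ P↭′ rule = stuck (out ++ rest′ , a , b , out , rest′ , rule , P↭′ , ↭-refl)
  with-q1 : ∀ {x out} → 1 ≤ r x → OtherRule 1 x out → ⊥
  with-q1 {x} present rule with extract rest x present
  ... | ys , rest↭ = impossible (5 ∷ ys) (↭-trans P↭ (Perm.prep 1 (↭-trans (Perm.prep 5 rest↭) (Perm.swap 5 x ↭-refl)))) rule
  with-q5 : ∀ {x out} → 1 ≤ r x → OtherRule 5 x out → ⊥
  with-q5 {x} present rule with extract rest x present
  ... | ys , rest↭ = impossible (1 ∷ ys)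
        (↭-trans P↭ (↭-trans (Perm.swap 1 5 ↭-refl) (Perm.prep 5 (↭-trans (Perm.prep 1 rest↭) (Perm.swap 1 x ↭-refl))))) rule
  within-rest : ∀ {x y out} → 1 ≤ r x → (∀ ys → rest ↭ x ∷ ys → 1 ≤ mult ys y) → OtherRule x y out → ⊥
  within-rest {x} {y} x-present y-present rule with extract rest x x-present
  ... | ys , rest↭ with extract ys y (y-present ys rest↭)
  ...   | zs , ys↭ = impossible (1 ∷ 5 ∷ zs)
          (↭-trans P↭ (↭-trans (Perm.prep 1 (Perm.prep 5 (↭-trans rest↭ (Perm.prep x ys↭)))) (rotate 1 5 x y zs))) rule
  rest1 : r 1 ≡ 0
  rest1 = absent λ present → with-q1 present r3a
  rest2 : r 2 ≡ 0
  rest2 = absent λ present → with-q1 present r1a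
  rest3 : r 3 ≡ 0
  rest3 = absent λ present → with-q1 present r5
  rest4 : r 4 ≡ 0
  rest4 = absent λ present → with-q1 present r4a₁
  rest5 : r 5 ≡ 0
  rest5 = absent λ present → with-q5 present r3e
  rest6 : r 6 ≡ 0
  rest6 = absent λ present → with-q5 present (r1b 5 <-decided)
  rest8 : r 8 ≡ 0
  rest8 = absent λ present → with-q5 present r4c₂
  rest9 : r 9 ≡ 0
  rest9 = absent λ present → with-q5 present (r2b 5 <-decided)
  other : ∀ {x y ys} → x ≢ y → rest ↭ x ∷ ys → mult ys y ≡ r y
  other {x} {y} {ys} x≢y rest↭ = sym (trans (mult-↭ rest↭ y) (cong (_+ mult ys y) (δ-diff x≢y)))
  -- large terms of the rest are simple, by rule (3g)
  rest-simple-large : ∀ x → 7 ≤ x → r x ≤ 1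
  rest-simple-large x 7≤x with zero-or-present (r x)
  ... | inj₁ rx≡0 = subst (_≤ 1) (sym rx≡0) z≤n
  ... | inj₂ present with ≤-<-connex (r x) 1
  ...   | inj₁ rx≤1 = rx≤1
  ...   | inj₂ rx>1 = ⊥-elim (within-rest present
          (λ ys rest↭ → ≤-pred (subst (2 ≤_) (trans (mult-↭ rest↭ x) (cong (_+ mult ys x) (δ-same x))) rx>1)) (r3g x 7≤x))
  rest-simple : ∀ x → 1 ≤ x → r x ≤ 1
  rest-simple 1 _ = subst (_≤ 1) (sym rest1) z≤n
  rest-simple 2 _ = subst (_≤ 1) (sym rest2) z≤n
  rest-simple 3 _ = subst (_≤ 1) (sym rest3) z≤n
  rest-simple 4 _ = subst (_≤ 1) (sym rest4) z≤n
  rest-simple 5 _ = subst (_≤ 1) (sym rest5) z≤n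
  rest-simple 6 _ = subst (_≤ 1) (sym rest6) z≤n
  rest-simple (suc (suc (suc (suc (suc (suc (suc x))))))) _ = rest-simple-large _ (m≤m+n 7 x)
  simple′ : ∀ x → 1 ≤ x → mult P' x ≤ 1
  simple′ x x≥1 with x ≟ 2 | x ≟ 4
  ... | yes refl | _ = ≤-reflexive (trans (after 2) (cong suc rest2))
  ... | no _ | yes refl = ≤-reflexive (trans (after 4) (cong suc rest4))
  ... | no x≢2 | no x≢4 = subst (_≤ 1) (sym (trans (after x) (cong₂ _+_ (δ-diff (≢-sym x≢2)) (cong (_+ r x) (δ-diff (≢-sym x≢4))))))
        (rest-simple x x≥1)
  small′ : ∀ x → 1 ≤ x → x ≤ 6 → mult P' x ≡ low-after-2a x
  small′ 1 _ _ = trans (after 1) rest1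
  small′ 2 _ _ = trans (after 2) (cong suc rest2)
  small′ 3 _ _ = trans (after 3) rest3
  small′ 4 _ _ = trans (after 4) (cong suc rest4)
  small′ 5 _ _ = trans (after 5) rest5
  small′ 6 _ _ = trans (after 6) rest6
  small′ (suc (suc (suc (suc (suc (suc (suc x))))))) _ x≤6 = ⊥-elim (<⇒≱ <-decided x≤6)
  large : ∀ x → 7 ≤ x → mult P' x ≡ r x
  large x 7≤x = trans (after x)
    (cong₂ _+_ (δ-diff (<⇒≢ (≤-trans (<-decided {2}) 7≤x))) (cong (_+ r x) (δ-diff (<⇒≢ (≤-trans (<-decided {4}) 7≤x)))))
  -- adjacent large terms of the rest could be merged by (1b), (4e) or (2b)
  sparse′ : ∀ x y → 7 ≤ x → x < y → 1 ≤ mult P' x → 1 ≤ mult P' y → ¬ Adjacent x y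
  sparse′ x y 7≤x x<y x-present y-present adjacent =
    within-rest x-in-rest (λ ys rest↭ → subst (1 ≤_) (sym (other (<⇒≢ x<y) rest↭)) y-in-rest) (proj₂ (merging adjacent))
    where
    x-in-rest : 1 ≤ r x
    x-in-rest = subst (1 ≤_) (large x 7≤x) x-present
    y-in-rest : 1 ≤ r y
    y-in-rest = subst (1 ≤_) (large y (≤-trans 7≤x (<⇒≤ x<y))) y-present
    merging : Adjacent x y → Σ (List ℕ) (OtherRule x y)
    merging (inj₁ refl) = _ , r1b x (≤-trans <-decided 7≤x)
    merging (inj₂ (inj₁ refl)) = _ , subst (λ m → OtherRule x m ((x ∸ 5) ∷ (x + 4) ∷ [])) (+-comm x 3) (r4e x 7≤x)
    merging (inj₂ (inj₂ refl)) = _ , subst (λ m → OtherRule x m ((x + 5) ∷ [])) (+-comm x 4) (r2b x (≤-trans <-decided 7≤x))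

reachable-shape : ∀ {n P k} → Reachable n P k → k ≡ 0 ⊎ (k ≡ 1 × Shape (mult P))
reachable-shape start = inj₁ refl
reachable-shape (stepOther R move) with reachable-shape R
... | inj₁ k≡0 = inj₁ k≡0
... | inj₂ (k≡1 , shape) = inj₂ (k≡1 , shape-step shape move)
reachable-shape (step2a R (stuck , rest , P↭ , P'↭)) with reachable-shape R
... | inj₁ refl = inj₂ (refl , inj₁ (after-2a-shape stuck P↭ P'↭))
... | inj₂ (refl , shape) = ⊥-elim (no-q5 shape (subst (1 ≤_) (sym (mult-↭ P↭ 5)) (s≤s z≤n)))

2a-at-most-once : (n : ℕ) (P : Position) (k : ℕ) → Reachable n P k → k ≤ 1
2a-at-most-once n P k R with reachable-shape R
... | inj₁ refl = z≤n
... | inj₂ (refl , _) = ≤-refl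

lemma2p3 : ((P P' : Position) → All (λ i → 1 ≤ i) P → OtherMove P P' → ΦLt P' P)
    × ((n : ℕ) (P : Position) (k : ℕ) → Reachable n P k → k ≤ 1)
lemma2p3 = (λ P P' _ move → Φ-decreases move) , 2a-at-most-once
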